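{- Let $n\ge1$, $\mathbf{k}\in\mathbb{Z}^n$, and $A=(A_1,\dots,A_n)\in\mathrm{MS}(\mathbb{Z},1)\times\cdots\times\mathrm{MS}(\mathbb{Z},n)$ with $A_n=\{\!\{k_1,\dots,k_n\}\!\}$. Then $\#\,\mathrm{GT}(\mathbf{k})|_{\eta_{\mathrm{row}}=A}=\mathrm{sgn}(\mathbf{k})$ if $A$ forms a classical Gelfand–Tsetlin pattern, and $0$ otherwise. In particular $\#\mathrm{GT}(\mathbf{k})=\mathrm{sgn}(\mathbf{k})\cdot\#\mathrm{GT}(\mathbf{k}')=\prod_{1\le i<j\le n}\frac{k_j-k_i}{j-i}$, where $\mathbf{k}'$ is the weakly increasing rearrangement of $\mathbf{k}$.
   Context: A signed set is a pair $S=(S^+,S^-)$ of disjoint finite sets, with support $|S|=S^+\sqcup S^-$ and size $\#S=\#S^+-\#S^-$. For a statistic $\eta$ on $|S|$ and a value $a$, the restriction is $S|_{\eta=a}=(\{s\in S^+:\eta(s)=a\},\{s\in S^-:\eta(s)=a\})$. The Cartesian product is $S\times T=(S^+\times T^+\sqcup S^-\times T^-,\ S^+\times T^-\sqcup S^-\times T^+)$. The disjoint union with signed index over a signed set $T$ of signed sets $S_t$ is $\bigsqcup_{t\in T}S_t=(\bigsqcup_{t\in T^+}S_t^+\sqcup\bigsqcup_{t\in T^- }S_t^-,\ \bigsqcup_{t\in T^+}S_t^-\sqcup\bigsqcup_{t\in T^- }S_t^+)$. The signed interval $[a,b)$ is $([a,b)\cap\mathbb{Z},\emptyset)$ if $a<b$,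 $(\emptyset,\emptyset)$ if $a=b$, and $(\emptyset,[b,a)\cap\mathbb{Z})$ if $a>b$. $\mathrm{GT}(k)=(\{k\},\emptyset)$ for $k\in\mathbb{Z}$. For $\mathbf{k}\in\mathbb{Z}^n$, $n\ge2$, set $\mathrm{GT}(\mathbf{k})=\bigsqcup_{\mathbf{l}\in[k_1,k_2)\times\cdots\times[k_{n-1},k_n)}\mathrm{GT}(\mathbf{l})$. Elements are signed triangular integer arrays with rows of lengths $1,\dots,n$ and bottom row $\mathbf{k}$. $\mathrm{MS}(\mathbb{Z},i)$ is the set of multisets of $i$ integers. $\eta_{\mathrm{row}}$ sends an element of $\mathrm{GT}(\mathbf{k})$ to the tuple of multisets of entries of its rows $1,\dots,n$. Write the elements of $A_i$ as $a_{i,1}\le\cdots\le a_{i,i}$. $A$ forms a classical Gelfand–Tsetlin pattern if $a_{i+1,j}\le a_{i,j}<a_{i+1,j+1}$ for all $1\le j\le i\le n-1$. $\mathrm{sgn}(\mathbf{k})$ is the sign of the permutation $s$ with $k_{s(1)}<\cdots<k_{s(n)}$ if the entries of $\mathbf{k}$ are distinct, and $0$ otherwise. -}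

module Defs where

open import Data.Nat as ℕ using (ℕ; zero; suc)
open import Data.Integer as ℤ using (ℤ; +_; -[1+_]; _-_; _≤_; _<_)
import Data.Integer.Properties as ℤP
open import Data.Rational as ℚ using (ℚ; _/_)
open import Data.List as L using (List; []; _∷_; _++_; concatMap; filter; length; cartesianProductWith)
open import Data.List.Properties using (≡-dec)
open import Data.List.Relation.Unary.Sorted.TotalOrder ℤP.≤-totalOrder using (Sorted)
open import Data.Vec as V using (Vec; []; _∷_; toList)
open import Data.Fin using (Fin; toℕ)
open import Data.Product using (Σ; _×_; _,_; proj₁)
open import Data.Unit using (⊤)
open import Data.Empty using (⊥)
open import Data.Bool using (Bool; true; false; if_then_else_; _∨_)
open import Relation.Nullary using (Dec; does)
open import Relation.Binary.PropositionalEquality using (_≡_)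
open import Relation.Binary.Definitions using (DecidableEquality)

import Data.List.Sort
open Data.List.Sort ℤP.≤-decTotalOrder public using (sort)

-- Signed sets, represented by two lists (positive / negative part).

record SSet (A : Set) : Set where
  constructor ⟨_,_⟩
  field
    pos : List A
    neg : List A
open SSet public

size : {A : Set} → SSet A → ℤ
size S = + length (pos S) - + length (neg S)

restrict : {A B : Set} → DecidableEquality B → (A → B) → B → SSet A → SSet A
restrict _≟_ η a S =
  ⟨ filter (λ s → η s ≟ a) (pos S) , filter (λ s → η s ≟ a) (neg S) ⟩

mapS : {A B : Set} → (A → B) → SSet A → SSet B
mapS f S = ⟨ L.map f (pos S) , L.map f (neg S) ⟩

prodWith : {A B C : Set} → (A → B → C) → SSet A → SSet B → SSet C
prodWith f S T =
  ⟨ cartesianProductWith f (pos S) (pos T) ++ cartesianProductWith f (neg S) (neg T)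
  , cartesianProductWith f (pos S) (neg T) ++ cartesianProductWith f (neg S) (pos T) ⟩

⨆ : {I A : Set} → SSet I → (I → SSet A) → SSet A
⨆ T S =
  ⟨ concatMap (λ t → pos (S t)) (pos T) ++ concatMap (λ t → neg (S t)) (neg T)
  , concatMap (λ t → neg (S t)) (pos T) ++ concatMap (λ t → pos (S t)) (neg T) ⟩

range : ℤ → ℕ → List ℤ
range a zero = []
range a (suc n) = a ∷ range (a ℤ.+ + 1) n

interval : ℤ → ℤ → SSet ℤ
interval a b with b - a
... | + zero = ⟨ [] , [] ⟩
... | + (suc m) = ⟨ range a (suc m) , [] ⟩
... | -[1+ m ] = ⟨ [] , range b (suc m) ⟩

intervals : ∀ {n} → Vec ℤ (suc (suc n)) → SSet (Vec ℤ (suc n))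
intervals {zero} (a ∷ b ∷ []) = mapS (λ x → x ∷ []) (interval a b)
intervals {suc n} (a ∷ b ∷ rest) = prodWith _∷_ (interval a b) (intervals (b ∷ rest))

-- Gelfand–Tsetlin patterns.  A (signed) triangular array is stored as the
-- list of its rows, from the top row (length 1) to the bottom row.

Pattern : Set
Pattern = List (List ℤ)

GT : (n : ℕ) → Vec ℤ (suc n) → SSet Pattern
GT zero k = ⟨ (toList k ∷ []) ∷ [] , [] ⟩
GT (suc n) k = ⨆ (intervals k) (λ l → mapS (λ p → p ++ (toList k ∷ [])) (GT n l))

-- Multisets of i integers, represented canonically as weakly increasing
-- vectors a_{i,1} ≤ ⋯ ≤ a_{i,i}.

MS : ℕ → Set
MS i = Σ (Vec ℤ i) (λ v → Sorted (toList v))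

msList : ∀ {i} → MS i → List ℤ
msList m = toList (proj₁ m)

ηrow : Pattern → List (List ℤ)
ηrow p = L.map sort p

MSTuple : ℕ → Set
MSTuple n = (i : Fin n) → MS (suc (toℕ i))

tupleRows : ∀ {n} → MSTuple n → List (List ℤ)
tupleRows {n} A = toList (V.tabulate (λ i → msList (A i)))

restrictRow : ∀ {n} → SSet Pattern → MSTuple n → SSet Pattern
restrictRow S A = restrict (≡-dec (≡-dec ℤ._≟_)) ηrow (tupleRows A) S

Interlace : List ℤ → List ℤ → Set
Interlace [] _ = ⊤
Interlace (a ∷ as) (b ∷ b' ∷ bs) = (b ≤ a × a < b') × Interlace as (b' ∷ bs)
Interlace (a ∷ as) _ = ⊥

ConsecInterlace : List (List ℤ) → Set
ConsecInterlace [] = ⊤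
ConsecInterlace (r ∷ []) = ⊤
ConsecInterlace (r ∷ r' ∷ rs) = Interlace r r' × ConsecInterlace (r' ∷ rs)

IsClassicalGT : ∀ {n} → MSTuple n → Set
IsClassicalGT A = ConsecInterlace (tupleRows A)

-- sgn(k): 0 if two entries coincide, otherwise the sign of the sorting
-- permutation, i.e. (-1)^(number of inversions of k).

occurs : ℤ → List ℤ → Bool
occurs x [] = false
occurs x (y ∷ ys) = does (x ℤ.≟ y) ∨ occurs x ys

hasTie : List ℤ → Bool
hasTie [] = false
hasTie (x ∷ xs) = occurs x xs ∨ hasTie xs

inversions : List ℤ → ℕ
inversions [] = 0
inversions (x ∷ xs) = length (filter (λ y → y ℤ.<? x) xs) ℕ.+ inversions xs

sgnL : List ℤ → ℤ
sgnL k = if hasTie k then + 0 else (ℤ.- + 1) ℤ.^ inversions k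

sgn : ∀ {n} → Vec ℤ n → ℤ
sgn k = sgnL (toList k)

prodRow : ℤ → ℕ → List ℤ → ℚ
prodRow x d [] = ℚ.1ℚ
prodRow x d (y ∷ ys) = ((y - x) / suc d) ℚ.* prodRow x (suc d) ys

prodFormula : List ℤ → ℚ
prodFormula [] = ℚ.1ℚ
prodFormula (x ∷ xs) = prodRow x 0 xs ℚ.* prodFormula xs

-- Every count is read off a determinant. Unfolding GT(k) once makes #GT(k) a signed sum over the box
-- [k₁,k₂) × ⋯ × [k_{n-1},k_n), and by multilinearity a box sum of det (R(lᵢ))ᵢ is the determinant of the
-- interval sums ∑_{x ∈ [kᵢ,kᵢ₊₁)} R(x). For the rows of falling factorials R(x) = (x(x-1)⋯(x-j+1))ⱼ these
-- interval sums are, column by column, consecutive differences, so by induction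
-- 1!2!⋯(n-1)! · #GT(k) = det (falling factorials of kᵢ), a Vandermonde determinant ∏ (kⱼ - kᵢ). This gives
-- the product formula, and sorting the rows of the determinant gives #GT(k) = sgn(k) · #GT(k′).
-- The restricted count goes by induction on n. For the second-to-last row multiset B,
-- det (𝟙(lᵢ = bⱼ)) = sgn(l) · [sort l = B]; the same box sum, followed by consecutive differences of the
-- rows (1, 𝟙(x ≤ bⱼ))ⱼ before and after sorting k, turns the sum over l into sgn(k) times the determinant
-- of the rows (𝟙(k′ᵢ ≤ bⱼ < k′ᵢ₊₁))ⱼ, which is 1 exactly when B interlaces k′ = sort k.

module Submission where

open import Defs
open import Data.Nat as ℕ using (ℕ; zero; suc; z≤n; s≤s; NonZero)
import Data.Nat.Properties as ℕP
open import Data.Integer as ℤ using (ℤ; +_; -[1+_]; 0ℤ; 1ℤ; _+_; _*_; -_; _-_; _^_; _≤_; _<_)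
import Data.Integer.Properties as ℤP
open import Data.Integer.Tactic.RingSolver using (solve-∀)
open import Data.Rational as ℚ using (ℚ; _/_)
import Data.Rational.Properties as ℚP
import Data.Rational.Unnormalised as ℚᵘ
import Data.Rational.Unnormalised.Properties as ℚᵘP
open import Data.Bool using (true; false; _∨_)
import Data.Bool.Properties as BoolP
open import Data.Empty using (⊥-elim)
open import Data.Unit using (tt)
open import Data.Product using (Σ-syntax; _,_; _×_; proj₁; proj₂)
open import Data.Sum using (_⊎_; inj₁; inj₂)
open import Data.Fin as F using (Fin; fromℕ; inject₁)
import Data.Fin.Properties as FP
open import Data.Vec as V using (Vec; []; _∷_; toList)
import Data.Vec.Properties as VP
open import Data.List using (List; []; _∷_; _++_; _∷ʳ_; length; map; concatMap; filter; cartesianProductWith)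
import Data.List.Properties as LP
open import Data.List.Relation.Unary.All as All using (All; []; _∷_)
open import Data.List.Relation.Unary.Linked as Linked using (Linked; []; [-]; _∷_)
import Data.List.Relation.Unary.Linked.Properties as LinkedP
open import Data.List.Relation.Unary.Sorted.TotalOrder ℤP.≤-totalOrder using (Sorted)
import Data.List.Relation.Unary.Sorted.TotalOrder.Properties as SortedP
open import Data.List.Relation.Binary.Pointwise as Pointwise using (Pointwise; []; _∷_; Pointwise-≡⇒≡)
import Data.List.Relation.Binary.Permutation.Propositional as ↭
open import Data.List.Relation.Binary.Permutation.Propositional using (_↭_; ↭⇒↭ₛ; ↭-sym; ↭-trans)
open import Data.List.Relation.Binary.Permutation.Propositional.Properties using (↭-length; filter-↭)
open import Data.List.Sort ℤP.≤-decTotalOrder using (sort-↭; sort-↗)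
open import Data.List.Sort.InsertionSort.Base ℤP.≤-decTotalOrder using (insert) renaming (sort to insertionSort)
import Data.List.Sort.InsertionSort.Properties ℤP.≤-decTotalOrder as InsertionSortP
open import Algebra.Bundles using (CommutativeMonoid)
import Algebra.Properties.CommutativeSemigroup as CommutativeSemigroupProperties
open import Function using (_∘_)
open import Function.Bundles using (mk⇔)
open import Relation.Binary.Definitions using (DecidableEquality; tri<; tri≈; tri>)
open import Relation.Binary.PropositionalEquality
open import Relation.Nullary using (Dec; yes; no; ¬_; does)
open import Relation.Nullary.Decidable using (_×-dec_; does-⇔)
open import Relation.Unary using (Pred; Decidable)

private
  variable
    A B C : Set

∑< : ℕ → (ℕ → ℤ) → ℤ
∑< zero    f = 0ℤ
∑< (suc n) f = f 0 + ∑< n (f ∘ suc)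

∏< : ℕ → (ℕ → ℤ) → ℤ
∏< zero    f = 1ℤ
∏< (suc n) f = f 0 * ∏< n (f ∘ suc)

∏ᴸ : List ℤ → ℤ
∏ᴸ []       = 1ℤ
∏ᴸ (x ∷ xs) = x * ∏ᴸ xs

∏<-cong : ∀ n {f g : ℕ → ℤ} → (∀ c → f c ≡ g c) → ∏< n f ≡ ∏< n g
∏<-cong zero    f≡g = refl
∏<-cong (suc n) f≡g = cong₂ _*_ (f≡g 0) (∏<-cong n (f≡g ∘ suc))

∑<-cong : ∀ n {f g : ℕ → ℤ} → (∀ j → j ℕ.< n → f j ≡ g j) → ∑< n f ≡ ∑< n g
∑<-cong zero    f≡g = refl
∑<-cong (suc n) f≡g = cong₂ _+_ (f≡g 0 (s≤s z≤n)) (∑<-cong n (λ j j<n → f≡g (suc j) (s≤s j<n)))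

∑<-zero : ∀ n {f : ℕ → ℤ} → (∀ j → j ℕ.< n → f j ≡ 0ℤ) → ∑< n f ≡ 0ℤ
∑<-zero zero    f≡0 = refl
∑<-zero (suc n) f≡0 = cong₂ _+_ (f≡0 0 (s≤s z≤n)) (∑<-zero n (λ j j<n → f≡0 (suc j) (s≤s j<n)))

∑<-linear : ∀ n a b (f g : ℕ → ℤ) → ∑< n (λ j → a * f j + b * g j) ≡ a * ∑< n f + b * ∑< n g
∑<-linear zero    a b f g = sym (cong₂ _+_ (ℤP.*-zeroʳ a) (ℤP.*-zeroʳ b))
∑<-linear (suc n) a b f g =
  trans (cong (λ t → a * f 0 + b * g 0 + t) (∑<-linear n a b (f ∘ suc) (g ∘ suc)))
        (regroup a b (f 0) (g 0) (∑< n (f ∘ suc)) (∑< n (g ∘ suc)))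
  where
  regroup : ∀ a b x y u v → (a * x + b * y) + (a * u + b * v) ≡ a * (x + u) + b * (y + v)
  regroup = solve-∀

*-distribˡ-∑< : ∀ n a (f : ℕ → ℤ) → ∑< n (λ j → a * f j) ≡ a * ∑< n f
*-distribˡ-∑< zero    a f = sym (ℤP.*-zeroʳ a)
*-distribˡ-∑< (suc n) a f =
  trans (cong (λ t → a * f 0 + t) (*-distribˡ-∑< n a (f ∘ suc))) (sym (ℤP.*-distribˡ-+ a (f 0) _))

∑<-cancel-adjacent : ∀ n p (f : ℕ → ℤ) → suc p ℕ.< n →
  (∀ j → j ℕ.< n → j ≢ p → j ≢ suc p → f j ≡ 0ℤ) → f p + f (suc p) ≡ 0ℤ → ∑< n f ≡ 0ℤ
∑<-cancel-adjacent (suc (suc n)) zero f _ others pair =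
  trans (cong (λ t → f 0 + (f 1 + t))
              (∑<-zero n (λ j j<n → others (suc (suc j)) (s≤s (s≤s j<n)) (λ ()) (λ ()))))
        (trans (cong (λ t → f 0 + t) (ℤP.+-identityʳ (f 1))) pair)
∑<-cancel-adjacent (suc n) (suc p) f (s≤s p<n) others pair =
  cong₂ _+_ (others 0 (s≤s z≤n) (λ ()) (λ ()))
            (∑<-cancel-adjacent n p (f ∘ suc) p<n
              (λ j j<n j≢p j≢p+1 → others (suc j) (s≤s j<n) (j≢p ∘ ℕP.suc-injective) (j≢p+1 ∘ ℕP.suc-injective))
              pair)

-- Determinants by expansion along the first column

Matrix : Set
Matrix = ℕ → ℕ → ℤ

punchIn : ℕ → ℕ → ℕ
punchIn zero    r       = suc r
punchIn (suc j) zero    = zero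
punchIn (suc j) (suc r) = suc (punchIn j r)

punchIn-< : ∀ {n} j r → j ℕ.< suc n → r ℕ.< n → punchIn j r ℕ.< suc n
punchIn-< zero r _ r<n = s≤s r<n
punchIn-< {suc n} (suc j) zero    _         _         = s≤s z≤n
punchIn-< {suc n} (suc j) (suc r) (s≤s j<n) (s≤s r<n) = s≤s (punchIn-< j r j<n r<n)

punchIn-injective : ∀ j r s → punchIn j r ≡ punchIn j s → r ≡ s
punchIn-injective zero    r       s       eq = ℕP.suc-injective eq
punchIn-injective (suc j) zero    zero    eq = refl
punchIn-injective (suc j) (suc r) (suc s) eq = cong suc (punchIn-injective j r s (ℕP.suc-injective eq))

punchInⱼ≢j : ∀ j r → punchIn j r ≢ j
punchInⱼ≢j (suc j) zero    ()
punchInⱼ≢j (suc j) (suc r) eq = punchInⱼ≢j j r (ℕP.suc-injective eq)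

punchIn-below : ∀ j r → r ℕ.< j → punchIn j r ≡ r
punchIn-below (suc j) zero    _         = refl
punchIn-below (suc j) (suc r) (s≤s r<j) = cong suc (punchIn-below j r r<j)

punchIn-above : ∀ j r → j ℕ.≤ r → punchIn j r ≡ suc r
punchIn-above zero    r       _         = refl
punchIn-above (suc j) (suc r) (s≤s j≤r) = cong suc (punchIn-above j r j≤r)

punchOut : ∀ {n} j p → j ≢ p → j ℕ.< suc n → p ℕ.< suc n → Σ[ q ∈ ℕ ] punchIn j q ≡ p × q ℕ.< n
punchOut zero    zero    j≢p _ _ = ⊥-elim (j≢p refl)
punchOut zero    (suc p) _   _ (s≤s p<n) = p , refl , p<n
punchOut {zero}  (suc j) _       _ (s≤s ()) _
punchOut {suc n} (suc j) zero    _ _ _ = zero , refl , s≤s z≤n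
punchOut {suc n} (suc j) (suc p) j≢p (s≤s j<n) (s≤s p<n)
  with q , refl , q<n ← punchOut {n} j p (j≢p ∘ cong suc) j<n p<n = suc q , refl , s≤s q<n

minor : ℕ → Matrix → Matrix
minor j M r c = M (punchIn j r) (suc c)

-- The determinant of the top-left n × n block of M.
detᴹ : ℕ → Matrix → ℤ
detᴹ zero    M = 1ℤ
detᴹ (suc n) M = ∑< (suc n) (λ j → (- 1ℤ) ^ j * M j 0 * detᴹ n (minor j M))

detᴹ-cong : ∀ n {M N : Matrix} → (∀ r c → r ℕ.< n → c ℕ.< n → M r c ≡ N r c) → detᴹ n M ≡ detᴹ n N
detᴹ-cong zero    M≡N = refl
detᴹ-cong (suc n) M≡N = ∑<-cong (suc n) λ j j<n →
  cong₂ _*_ (cong ((- 1ℤ) ^ j *_) (M≡N j 0 j<n (s≤s z≤n)))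
            (detᴹ-cong n (λ r c r<n c<n → M≡N (punchIn j r) (suc c) (punchIn-< j r j<n r<n) (s≤s c<n)))

detᴹ-linear : ∀ n p {M M₁ M₂ : Matrix} a b → p ℕ.< n →
  (∀ r → r ≢ p → ∀ c → M r c ≡ M₁ r c) → (∀ r → r ≢ p → ∀ c → M r c ≡ M₂ r c) →
  (∀ c → M p c ≡ a * M₁ p c + b * M₂ p c) → detᴹ n M ≡ a * detᴹ n M₁ + b * detᴹ n M₂
detᴹ-linear (suc n) p {M} {M₁} {M₂} a b p<n M≡M₁ M≡M₂ Mₚ =
  trans (∑<-cong (suc n) term) (∑<-linear (suc n) a b (summand M₁) (summand M₂))
  where
  summand : Matrix → ℕ → ℤ
  summand N j = (- 1ℤ) ^ j * N j 0 * detᴹ n (minor j N)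

  linear-entry : ∀ a b s x₁ x₂ d → s * (a * x₁ + b * x₂) * d ≡ a * (s * x₁ * d) + b * (s * x₂ * d)
  linear-entry = solve-∀

  linear-minor : ∀ a b s x d₁ d₂ → s * x * (a * d₁ + b * d₂) ≡ a * (s * x * d₁) + b * (s * x * d₂)
  linear-minor = solve-∀

  term : ∀ j → j ℕ.< suc n → summand M j ≡ a * summand M₁ j + b * summand M₂ j
  term j j<n with j ℕ.≟ p
  ... | yes refl =
    trans (cong₂ (λ x d → (- 1ℤ) ^ j * x * d) (Mₚ 0) minor≡minor₁)
      (trans (linear-entry a b ((- 1ℤ) ^ j) (M₁ j 0) (M₂ j 0) (detᴹ n (minor j M₁)))
             (cong (λ d → a * summand M₁ j + b * ((- 1ℤ) ^ j * M₂ j 0 * d)) (trans (sym minor≡minor₁) minor≡minor₂)))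
    where
    minor≡minor₁ : detᴹ n (minor j M) ≡ detᴹ n (minor j M₁)
    minor≡minor₁ = detᴹ-cong n (λ r c _ _ → M≡M₁ (punchIn j r) (punchInⱼ≢j j r) (suc c))
    minor≡minor₂ : detᴹ n (minor j M) ≡ detᴹ n (minor j M₂)
    minor≡minor₂ = detᴹ-cong n (λ r c _ _ → M≡M₂ (punchIn j r) (punchInⱼ≢j j r) (suc c))
  ... | no j≢p with q , jq≡p , q<n ← punchOut j p j≢p j<n p<n =
    trans (cong ((- 1ℤ) ^ j * M j 0 *_) (detᴹ-linear n q a b q<n (away M≡M₁) (away M≡M₂) row-q))
      (trans (linear-minor a b ((- 1ℤ) ^ j) (M j 0) _ _)
             (cong₂ (λ x₁ x₂ → a * ((- 1ℤ) ^ j * x₁ * _) + b * ((- 1ℤ) ^ j * x₂ * _)) (M≡M₁ j j≢p 0) (M≡M₂ j j≢p 0)))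
    where
    away : ∀ {N} → (∀ r → r ≢ p → ∀ c → M r c ≡ N r c) → ∀ r → r ≢ q → ∀ c → minor j M r c ≡ minor j N r c
    away M≡N r r≢q c = M≡N (punchIn j r) (λ e → r≢q (punchIn-injective j r q (trans e (sym jq≡p)))) (suc c)
    row-q : ∀ c → minor j M q c ≡ a * minor j M₁ q c + b * minor j M₂ q c
    row-q c = subst (λ t → M t (suc c) ≡ a * M₁ t (suc c) + b * M₂ t (suc c)) (sym jq≡p) (Mₚ (suc c))

minor-adjacent : ∀ p (M : Matrix) → (∀ c → M p c ≡ M (suc p) c) → ∀ r c → minor p M r c ≡ minor (suc p) M r c
minor-adjacent zero    M Mₚ≡Mₚ₊₁ zero    c = sym (Mₚ≡Mₚ₊₁ (suc c))
minor-adjacent zero    M Mₚ≡Mₚ₊₁ (suc r) c = refl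
minor-adjacent (suc p) M Mₚ≡Mₚ₊₁ zero    c = refl
minor-adjacent (suc p) M Mₚ≡Mₚ₊₁ (suc r) c = minor-adjacent p (M ∘ suc) Mₚ≡Mₚ₊₁ r c

-- The two terms of rows p and p+1 cancel, and every other minor still has two equal adjacent rows.
detᴹ-adjacent-equal : ∀ n p {M : Matrix} → suc p ℕ.< n → (∀ c → M p c ≡ M (suc p) c) → detᴹ n M ≡ 0ℤ
detᴹ-adjacent-equal (suc n) p {M} p+1<n Mₚ≡Mₚ₊₁ = ∑<-cancel-adjacent (suc n) p summand p+1<n others pair
  where
  summand : ℕ → ℤ
  summand j = (- 1ℤ) ^ j * M j 0 * detᴹ n (minor j M)

  minor-vanishes : ∀ j q → (∀ c → minor j M q c ≡ minor j M (suc q) c) → suc q ℕ.< n → summand j ≡ 0ℤ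
  minor-vanishes j q rows≡ q+1<n =
    trans (cong ((- 1ℤ) ^ j * M j 0 *_) (detᴹ-adjacent-equal n q q+1<n rows≡)) (ℤP.*-zeroʳ ((- 1ℤ) ^ j * M j 0))

  others : ∀ j → j ℕ.< suc n → j ≢ p → j ≢ suc p → summand j ≡ 0ℤ
  others j j<n j≢p j≢p+1 with ℕP.<-cmp j p
  ... | tri≈ _ j≡p _ = ⊥-elim (j≢p j≡p)
  ... | tri< j<p _ _ = vanishes-below p Mₚ≡Mₚ₊₁ j<p p+1<n
    where
    vanishes-below : ∀ p′ → (∀ c → M p′ c ≡ M (suc p′) c) → j ℕ.< p′ → suc p′ ℕ.< suc n → summand j ≡ 0ℤ
    vanishes-below (suc q) rows≡ j<q+1 (s≤s q+1<n) = minor-vanishes j q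
      (λ c → trans (cong (λ t → M t (suc c)) (punchIn-above j q (ℕP.≤-pred j<q+1)))
               (trans (rows≡ (suc c)) (cong (λ t → M t (suc c)) (sym (punchIn-above j (suc q) (ℕP.m≤n⇒m≤1+n (ℕP.≤-pred j<q+1)))))))
      q+1<n
  ... | tri> _ _ p<j with ℕP.<-cmp j (suc p)
  ...   | tri≈ _ j≡p+1 _ = ⊥-elim (j≢p+1 j≡p+1)
  ...   | tri< j<p+1 _ _ = ⊥-elim (ℕP.<-irrefl refl (ℕP.<-≤-trans j<p+1 p<j))
  ...   | tri> _ _ p+1<j =
    minor-vanishes j p
      (λ c → trans (cong (λ t → M t (suc c)) (punchIn-below j p p<j))
               (trans (Mₚ≡Mₚ₊₁ (suc c)) (cong (λ t → M t (suc c)) (sym (punchIn-below j (suc p) p+1<j)))))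
      (ℕP.<-≤-trans p+1<j (ℕP.≤-pred j<n))

  cancel : ∀ s x d → s * x * d + (- 1ℤ * s) * x * d ≡ 0ℤ
  cancel = solve-∀

  pair : summand p + summand (suc p) ≡ 0ℤ
  pair = trans (cong₂ (λ x d → summand p + (- 1ℤ * (- 1ℤ) ^ p) * x * d) (sym (Mₚ≡Mₚ₊₁ 0))
                      (sym (detᴹ-cong n (λ r c _ _ → minor-adjacent p M Mₚ≡Mₚ₊₁ r c))))
               (cancel ((- 1ℤ) ^ p) (M p 0) (detᴹ n (minor p M)))

detᴹ-scale-columns : ∀ n {M N : Matrix} (g : ℕ → ℤ) → (∀ r c → M r c ≡ g c * N r c) → detᴹ n M ≡ ∏< n g * detᴹ n N
detᴹ-scale-columns zero    g M≡gN = sym (ℤP.*-identityˡ 1ℤ)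
detᴹ-scale-columns (suc n) {M} {N} g M≡gN =
  trans (∑<-cong (suc n) (λ j _ →
          trans (cong₂ (λ x d → (- 1ℤ) ^ j * x * d) (M≡gN j 0) (detᴹ-scale-columns n (g ∘ suc) (λ r c → M≡gN (punchIn j r) (suc c))))
                (regroup ((- 1ℤ) ^ j) (g 0) (N j 0) (∏< n (g ∘ suc)) (detᴹ n (minor j N)))))
        (*-distribˡ-∑< (suc n) (g 0 * ∏< n (g ∘ suc)) (λ j → (- 1ℤ) ^ j * N j 0 * detᴹ n (minor j N)))
  where
  regroup : ∀ s g x P D → s * (g * x) * (P * D) ≡ (g * P) * (s * x * D)
  regroup = solve-∀

Row : Set
Row = ℕ → ℤ

toMatrix : List Row → Matrix
toMatrix []       r       c = 0ℤ
toMatrix (x ∷ xs) zero    c = x c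
toMatrix (x ∷ xs) (suc r) c = toMatrix xs r c

det : List Row → ℤ
det rs = detᴹ (length rs) (toMatrix rs)

det-cong : ∀ {rs ss} → Pointwise _≗_ rs ss → det rs ≡ det ss
det-cong {rs} {ss} rs≋ss =
  trans (detᴹ-cong (length rs) (λ r c _ _ → entries rs≋ss r c)) (cong (λ n → detᴹ n (toMatrix ss)) (Pointwise.Pointwise-length rs≋ss))
  where
  entries : ∀ {rs ss} → Pointwise _≗_ rs ss → ∀ r c → toMatrix rs r c ≡ toMatrix ss r c
  entries []           r       c = refl
  entries (x≗y ∷ _)    zero    c = x≗y c
  entries (_ ∷ rs≋ss)  (suc r) c = entries rs≋ss r c

det-map-cong : ∀ {R S : A → Row} → (∀ x → R x ≗ S x) → ∀ xs → det (map R xs) ≡ det (map S xs)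
det-map-cong R≗S xs = det-cong (pointwise xs)
  where
  pointwise : ∀ xs → Pointwise _≗_ (map _ xs) (map _ xs)
  pointwise []       = []
  pointwise (x ∷ xs) = R≗S x ∷ pointwise xs

private
  length-middle : ∀ (pre : List Row) x y post → length (pre ++ x ∷ post) ≡ length (pre ++ y ∷ post)
  length-middle pre x y post = trans (LP.length-++ pre) (sym (LP.length-++ pre))

  middle-< : ∀ (pre : List Row) x post → length pre ℕ.< length (pre ++ x ∷ post)
  middle-< []       x post = s≤s z≤n
  middle-< (_ ∷ ps) x post = s≤s (middle-< ps x post)

  toMatrix-middle : ∀ (pre : List Row) x post c → toMatrix (pre ++ x ∷ post) (length pre) c ≡ x c
  toMatrix-middle []       x post c = refl
  toMatrix-middle (_ ∷ ps) x post c = toMatrix-middle ps x post c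

  next-< : ∀ (pre : List Row) x y post → suc (length pre) ℕ.< length (pre ++ x ∷ y ∷ post)
  next-< []       x y post = s≤s (s≤s z≤n)
  next-< (_ ∷ ps) x y post = s≤s (next-< ps x y post)

  toMatrix-next : ∀ (pre : List Row) x y post c → toMatrix (pre ++ x ∷ y ∷ post) (suc (length pre)) c ≡ y c
  toMatrix-next []       x y post c = refl
  toMatrix-next (_ ∷ ps) x y post c = toMatrix-next ps x y post c

  toMatrix-away : ∀ (pre : List Row) x y post r → r ≢ length pre → ∀ c →
    toMatrix (pre ++ x ∷ post) r c ≡ toMatrix (pre ++ y ∷ post) r c
  toMatrix-away []       x y post zero    r≢0 c = ⊥-elim (r≢0 refl)
  toMatrix-away []       x y post (suc r) _   c = refl
  toMatrix-away (_ ∷ ps) x y post zero    _   c = refl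
  toMatrix-away (_ ∷ ps) x y post (suc r) r≢  c = toMatrix-away ps x y post r (r≢ ∘ cong suc) c

det-linear : ∀ (pre : List Row) w u v post a b → (∀ c → w c ≡ a * u c + b * v c) →
  det (pre ++ w ∷ post) ≡ a * det (pre ++ u ∷ post) + b * det (pre ++ v ∷ post)
det-linear pre w u v post a b w≡au+bv =
  trans (detᴹ-linear (length (pre ++ w ∷ post)) (length pre) a b (middle-< pre w post)
          (toMatrix-away pre w u post) (toMatrix-away pre w v post)
          (λ c → trans (toMatrix-middle pre w post c)
                   (trans (w≡au+bv c) (sym (cong₂ (λ x y → a * x + b * y) (toMatrix-middle pre u post c) (toMatrix-middle pre v post c))))))
        (cong₂ (λ m n → a * detᴹ m (toMatrix (pre ++ u ∷ post)) + b * detᴹ n (toMatrix (pre ++ v ∷ post)))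
          (length-middle pre w u post) (length-middle pre w v post))

det-adjacent-equal : ∀ (pre : List Row) x y post → x ≗ y → det (pre ++ x ∷ y ∷ post) ≡ 0ℤ
det-adjacent-equal pre x y post x≗y =
  detᴹ-adjacent-equal (length (pre ++ x ∷ y ∷ post)) (length pre) (next-< pre x y post)
    (λ c → trans (toMatrix-middle pre x (y ∷ post) c) (trans (x≗y c) (sym (toMatrix-next pre x y post c))))

det-zero-row : ∀ (pre : List Row) z post → (∀ c → z c ≡ 0ℤ) → det (pre ++ z ∷ post) ≡ 0ℤ
det-zero-row pre z post z≡0 =
  trans (det-linear pre z z z post 0ℤ 0ℤ (λ c → trans (z≡0 c) (sym (zero-combination (z c)))))
        (zero-combination (det (pre ++ z ∷ post)))
  where
  zero-combination : ∀ x → 0ℤ * x + 0ℤ * x ≡ 0ℤ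
  zero-combination = solve-∀

-- Expanding det (pre ++ (x + y) ∷ (x + y) ∷ post) = 0 by linearity leaves only the two mixed terms.
det-swap : ∀ (pre : List Row) x y post → det (pre ++ x ∷ y ∷ post) ≡ - det (pre ++ y ∷ x ∷ post)
det-swap pre x y post = opposite (det (pre ++ x ∷ y ∷ post)) (det (pre ++ y ∷ x ∷ post)) (trans (sym expand) s-s)
  where
  s : Row
  s c = x c + y c

  s≡x+y : ∀ c → s c ≡ 1ℤ * x c + 1ℤ * y c
  s≡x+y c = sym (cong₂ _+_ (ℤP.*-identityˡ (x c)) (ℤP.*-identityˡ (y c)))

  s-s : det (pre ++ s ∷ s ∷ post) ≡ 0ℤ
  s-s = det-adjacent-equal pre s s post (λ _ → refl)

  second : ∀ z → det (pre ++ z ∷ s ∷ post) ≡ 1ℤ * det (pre ++ z ∷ x ∷ post) + 1ℤ * det (pre ++ z ∷ y ∷ post)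
  second z = trans (cong det (sym (LP.∷ʳ-++ pre z (s ∷ post))))
    (trans (det-linear (pre ∷ʳ z) s x y post 1ℤ 1ℤ s≡x+y)
           (cong₂ (λ u v → 1ℤ * det u + 1ℤ * det v) (LP.∷ʳ-++ pre z (x ∷ post)) (LP.∷ʳ-++ pre z (y ∷ post))))

  expand : det (pre ++ s ∷ s ∷ post) ≡ det (pre ++ x ∷ y ∷ post) + det (pre ++ y ∷ x ∷ post)
  expand = trans (det-linear pre s x y (s ∷ post) 1ℤ 1ℤ s≡x+y)
    (trans (cong₂ (λ u v → 1ℤ * u + 1ℤ * v)
             (trans (second x) (cong (λ t → 1ℤ * t + 1ℤ * det (pre ++ x ∷ y ∷ post)) (det-adjacent-equal pre x x post (λ _ → refl))))
             (trans (second y) (cong (λ t → 1ℤ * det (pre ++ y ∷ x ∷ post) + 1ℤ * t) (det-adjacent-equal pre y y post (λ _ → refl)))))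
      (simplify (det (pre ++ x ∷ y ∷ post)) (det (pre ++ y ∷ x ∷ post))))
    where
    simplify : ∀ a b → 1ℤ * (1ℤ * 0ℤ + 1ℤ * a) + 1ℤ * (1ℤ * b + 1ℤ * 0ℤ) ≡ a + b
    simplify = solve-∀

  opposite : ∀ a b → a + b ≡ 0ℤ → a ≡ - b
  opposite a b a+b≡0 = trans (rearrange a b) (trans (cong (_- b) a+b≡0) (ℤP.+-identityˡ (- b)))
    where
    rearrange : ∀ a b → a ≡ (a + b) - b
    rearrange = solve-∀

det-repeated : ∀ (pre : List Row) x mid y post → x ≗ y → det (pre ++ x ∷ mid ++ y ∷ post) ≡ 0ℤ
det-repeated pre x []        y post x≗y = det-adjacent-equal pre x y post x≗y
det-repeated pre x (m ∷ mid) y post x≗y =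
  trans (det-swap pre x m (mid ++ y ∷ post))
        (cong -_ (trans (cong det (sym (LP.∷ʳ-++ pre m (x ∷ mid ++ y ∷ post))))
                        (det-repeated (pre ∷ʳ m) x mid y post x≗y)))

det-subtract-earlier : ∀ (pre : List Row) q mid w post →
  det (pre ++ q ∷ mid ++ w ∷ post) ≡ det (pre ++ q ∷ mid ++ (λ c → w c - q c) ∷ post)
det-subtract-earlier pre q mid w post =
  trans (cong det (reassoc w))
    (trans (det-linear (pre ++ q ∷ mid) w (λ c → w c - q c) q post 1ℤ 1ℤ (λ c → split (w c) (q c)))
      (trans (cong₂ (λ u v → 1ℤ * det u + 1ℤ * v) (sym (reassoc (λ c → w c - q c)))
                    (trans (cong det (sym (reassoc q))) (det-repeated pre q mid q post (λ _ → refl))))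
             (drop-zero (det (pre ++ q ∷ mid ++ (λ c → w c - q c) ∷ post)))))
  where
  reassoc : ∀ r → pre ++ q ∷ mid ++ r ∷ post ≡ (pre ++ q ∷ mid) ++ r ∷ post
  reassoc r = sym (LP.++-assoc pre (q ∷ mid) (r ∷ post))
  split : ∀ w q → w ≡ 1ℤ * (w - q) + 1ℤ * q
  split = solve-∀
  drop-zero : ∀ d → 1ℤ * d + 1ℤ * 0ℤ ≡ d
  drop-zero = solve-∀

det-subtract-first : ∀ q (R : A → Row) xs → det (q ∷ map R xs) ≡ det (q ∷ map (λ x c → R x c - q c) xs)
det-subtract-first q R = go []
  where
  go : ∀ mid xs → det (q ∷ mid ++ map R xs) ≡ det (q ∷ mid ++ map (λ x c → R x c - q c) xs)
  go mid []       = refl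
  go mid (x ∷ xs) =
    trans (det-subtract-earlier [] q mid (R x) (map R xs))
     (trans (cong (λ rs → det (q ∷ rs)) (sym (LP.∷ʳ-++ mid _ (map R xs))))
      (trans (go (mid ∷ʳ (λ c → R x c - q c)) xs)
             (cong (λ rs → det (q ∷ rs)) (LP.∷ʳ-++ mid _ _))))

det-scale-columns : ∀ {g : ℕ → ℤ} {us vs} → Pointwise (λ u v → ∀ c → u c ≡ g c * v c) us vs →
  det us ≡ ∏< (length vs) g * det vs
det-scale-columns {g} {us} {vs} us≡gvs =
  trans (detᴹ-scale-columns (length us) g (entries us≡gvs))
        (cong (λ n → ∏< n g * detᴹ n (toMatrix vs)) (Pointwise.Pointwise-length us≡gvs))
  where
  entries : ∀ {us vs} → Pointwise (λ u v → ∀ c → u c ≡ g c * v c) us vs → ∀ r c → toMatrix us r c ≡ g c * toMatrix vs r c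
  entries []              r       c = sym (ℤP.*-zeroʳ (g c))
  entries (u≡gv ∷ _)      zero    c = u≡gv c
  entries (_ ∷ us≡gvs)    (suc r) c = entries us≡gvs r c

det-scale-rows : ∀ (pre : List Row) (h : A → ℤ) {S R : A → Row} → (∀ x c → S x c ≡ h x * R x c) →
  ∀ xs → det (pre ++ map S xs) ≡ ∏ᴸ (map h xs) * det (pre ++ map R xs)
det-scale-rows pre h S≡hR []       = sym (ℤP.*-identityˡ _)
det-scale-rows pre h {S} {R} S≡hR (x ∷ xs) =
  trans (det-linear pre (S x) (R x) (R x) (map S xs) (h x) 0ℤ (λ c → trans (S≡hR x c) (sym (ℤP.+-identityʳ _))))
   (trans (cong (λ d → h x * d + 0ℤ * det (pre ++ R x ∷ map S xs)) rest)
          (regroup (h x) (∏ᴸ (map h xs)) (det (pre ++ R x ∷ map R xs)) (det (pre ++ R x ∷ map S xs))))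
  where
  rest : det (pre ++ R x ∷ map S xs) ≡ ∏ᴸ (map h xs) * det (pre ++ R x ∷ map R xs)
  rest = trans (cong det (sym (LP.∷ʳ-++ pre (R x) (map S xs))))
    (trans (det-scale-rows (pre ∷ʳ R x) h S≡hR xs) (cong (λ rs → ∏ᴸ (map h xs) * det rs) (LP.∷ʳ-++ pre (R x) (map R xs))))
  regroup : ∀ h P D D′ → h * (P * D) + 0ℤ * D′ ≡ h * P * D
  regroup = solve-∀

det-∷-zero-column : ∀ r rs → All (λ v → v 0 ≡ 0ℤ) rs → det (r ∷ rs) ≡ r 0 * det (map (_∘ suc) rs)
det-∷-zero-column r rs column≡0 =
  trans (cong (λ t → 1ℤ * r 0 * detᴹ n (minor 0 M) + t) (∑<-zero n (λ j _ → other-rows j)))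
   (trans (ℤP.+-identityʳ _)
     (cong₂ _*_ (ℤP.*-identityˡ (r 0))
                (trans (detᴹ-cong n (λ i c _ _ → sym (toMatrix-tail rs i c)))
                       (cong (λ m → detᴹ m (toMatrix (map (_∘ suc) rs))) (sym (LP.length-map (_∘ suc) rs))))))
  where
  n = length rs
  M = toMatrix (r ∷ rs)

  toMatrix-tail : ∀ rs i c → toMatrix (map (_∘ suc) rs) i c ≡ toMatrix rs i (suc c)
  toMatrix-tail []       i       c = refl
  toMatrix-tail (_ ∷ _)  zero    c = refl
  toMatrix-tail (_ ∷ rs) (suc i) c = toMatrix-tail rs i c

  first-column : ∀ {rs} → All (λ v → v 0 ≡ 0ℤ) rs → ∀ j → toMatrix rs j 0 ≡ 0ℤ
  first-column []            j       = refl
  first-column (v₀≡0 ∷ _)   zero    = v₀≡0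
  first-column (_ ∷ column) (suc j) = first-column column j

  other-rows : ∀ j → (- 1ℤ) ^ suc j * M (suc j) 0 * detᴹ n (minor (suc j) M) ≡ 0ℤ
  other-rows j = trans (cong (λ x → (- 1ℤ) ^ suc j * x * detᴹ n (minor (suc j) M)) (first-column column≡0 j))
                       (trans (cong (_* detᴹ n (minor (suc j) M)) (ℤP.*-zeroʳ ((- 1ℤ) ^ suc j))) (ℤP.*-zeroˡ (detᴹ n (minor (suc j) M))))

𝟙 : {P : Set} → Dec P → ℤ
𝟙 (yes _) = 1ℤ
𝟙 (no _)  = 0ℤ

𝟙-yes : ∀ {P : Set} (P? : Dec P) → P → 𝟙 P? ≡ 1ℤ
𝟙-yes (yes _) _ = refl
𝟙-yes (no ¬p) p = ⊥-elim (¬p p)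

𝟙-no : ∀ {P : Set} (P? : Dec P) → ¬ P → 𝟙 P? ≡ 0ℤ
𝟙-no (yes p) ¬p = ⊥-elim (¬p p)
𝟙-no (no _)  _  = refl

𝟙-⇔ : ∀ {P Q : Set} (P? : Dec P) (Q? : Dec Q) → (P → Q) → (Q → P) → 𝟙 P? ≡ 𝟙 Q?
𝟙-⇔ (yes p) Q? P⇒Q Q⇒P = sym (𝟙-yes Q? (P⇒Q p))
𝟙-⇔ (no ¬p) Q? P⇒Q Q⇒P = sym (𝟙-no Q? (¬p ∘ Q⇒P))

𝟙-× : ∀ {P Q : Set} (P? : Dec P) (Q? : Dec Q) → 𝟙 (P? ×-dec Q?) ≡ 𝟙 P? * 𝟙 Q?
𝟙-× (yes _) (yes _) = refl
𝟙-× (yes _) (no _)  = refl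
𝟙-× (no _)  (yes _) = refl
𝟙-× (no _)  (no _)  = refl

∑ᴸ : List A → (A → ℤ) → ℤ
∑ᴸ []       f = 0ℤ
∑ᴸ (x ∷ xs) f = f x + ∑ᴸ xs f

∑ˢ : SSet A → (A → ℤ) → ℤ
∑ˢ S f = ∑ᴸ (pos S) f - ∑ᴸ (neg S) f

∑ᴸ-cong : ∀ (xs : List A) {f g} → (∀ x → f x ≡ g x) → ∑ᴸ xs f ≡ ∑ᴸ xs g
∑ᴸ-cong []       f≡g = refl
∑ᴸ-cong (x ∷ xs) f≡g = cong₂ _+_ (f≡g x) (∑ᴸ-cong xs f≡g)

∑ᴸ-++ : ∀ (xs ys : List A) f → ∑ᴸ (xs ++ ys) f ≡ ∑ᴸ xs f + ∑ᴸ ys f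
∑ᴸ-++ []       ys f = sym (ℤP.+-identityˡ _)
∑ᴸ-++ (x ∷ xs) ys f = trans (cong (λ t → f x + t) (∑ᴸ-++ xs ys f)) (sym (ℤP.+-assoc (f x) _ _))

∑ᴸ-sub : ∀ (xs : List A) f g → ∑ᴸ xs (λ x → f x - g x) ≡ ∑ᴸ xs f - ∑ᴸ xs g
∑ᴸ-sub []       f g = refl
∑ᴸ-sub (x ∷ xs) f g = trans (cong (λ t → f x - g x + t) (∑ᴸ-sub xs f g)) (regroup (f x) (g x) (∑ᴸ xs f) (∑ᴸ xs g))
  where
  regroup : ∀ a b c d → a - b + (c - d) ≡ (a + c) - (b + d)
  regroup = solve-∀

*-distribˡ-∑ᴸ : ∀ (xs : List A) a f → ∑ᴸ xs (λ x → a * f x) ≡ a * ∑ᴸ xs f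
*-distribˡ-∑ᴸ []       a f = sym (ℤP.*-zeroʳ a)
*-distribˡ-∑ᴸ (x ∷ xs) a f = trans (cong (λ t → a * f x + t) (*-distribˡ-∑ᴸ xs a f)) (sym (ℤP.*-distribˡ-+ a (f x) _))

∑ᴸ-0 : ∀ (xs : List A) → ∑ᴸ xs (λ _ → 0ℤ) ≡ 0ℤ
∑ᴸ-0 []       = refl
∑ᴸ-0 (x ∷ xs) = trans (ℤP.+-identityˡ _) (∑ᴸ-0 xs)

∑ᴸ-filter : ∀ {P : Pred A _} (P? : Decidable P) (xs : List A) → + length (filter P? xs) ≡ ∑ᴸ xs (𝟙 ∘ P?)
∑ᴸ-filter P? []       = refl
∑ᴸ-filter P? (x ∷ xs) with P? x
... | yes _ = trans (sym (ℤP.pos-+ 1 (length (filter P? xs)))) (cong (λ t → 1ℤ + t) (∑ᴸ-filter P? xs))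
... | no _  = trans (∑ᴸ-filter P? xs) (sym (ℤP.+-identityˡ _))

∑ᴸ-1 : ∀ (xs : List A) → + length xs ≡ ∑ᴸ xs (λ _ → 1ℤ)
∑ᴸ-1 []       = refl
∑ᴸ-1 (x ∷ xs) = trans (sym (ℤP.pos-+ 1 (length xs))) (cong (λ t → 1ℤ + t) (∑ᴸ-1 xs))

∑ᴸ-map : ∀ (g : A → B) (xs : List A) f → ∑ᴸ (map g xs) f ≡ ∑ᴸ xs (f ∘ g)
∑ᴸ-map g []       f = refl
∑ᴸ-map g (x ∷ xs) f = cong (λ t → f (g x) + t) (∑ᴸ-map g xs f)

∑ᴸ-concatMap : ∀ (h : A → List B) (xs : List A) f → ∑ᴸ (concatMap h xs) f ≡ ∑ᴸ xs (λ x → ∑ᴸ (h x) f)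
∑ᴸ-concatMap h []       f = refl
∑ᴸ-concatMap h (x ∷ xs) f = trans (∑ᴸ-++ (h x) (concatMap h xs) f) (cong (λ t → ∑ᴸ (h x) f + t) (∑ᴸ-concatMap h xs f))

∑ᴸ-cartesianProductWith : ∀ (g : A → B → C) (xs : List A) (ys : List B) f →
  ∑ᴸ (cartesianProductWith g xs ys) f ≡ ∑ᴸ xs (λ x → ∑ᴸ ys (f ∘ g x))
∑ᴸ-cartesianProductWith g []       ys f = refl
∑ᴸ-cartesianProductWith g (x ∷ xs) ys f =
  trans (∑ᴸ-++ (map (g x) ys) _ f) (cong₂ _+_ (∑ᴸ-map (g x) ys f) (∑ᴸ-cartesianProductWith g xs ys f))

private
  a*x-a*y≡a*[x-y] : ∀ a x y → a * x - a * y ≡ a * (x - y)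
  a*x-a*y≡a*[x-y] = solve-∀

  a+[b-a]≡b : ∀ a b → a + (b - a) ≡ b
  a+[b-a]≡b = solve-∀

  regroup-signs : ∀ a b c d → (a + b) - (c + d) ≡ (a - c) - (d - b)
  regroup-signs = solve-∀

∑ˢ-cong : ∀ (S : SSet A) {f g} → (∀ x → f x ≡ g x) → ∑ˢ S f ≡ ∑ˢ S g
∑ˢ-cong S f≡g = cong₂ _-_ (∑ᴸ-cong (pos S) f≡g) (∑ᴸ-cong (neg S) f≡g)

*-distribˡ-∑ˢ : ∀ (S : SSet A) a f → ∑ˢ S (λ x → a * f x) ≡ a * ∑ˢ S f
*-distribˡ-∑ˢ S a f =
  trans (cong₂ _-_ (*-distribˡ-∑ᴸ (pos S) a f) (*-distribˡ-∑ᴸ (neg S) a f)) (a*x-a*y≡a*[x-y] a _ _)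

∑ˢ-0 : ∀ (S : SSet A) → ∑ˢ S (λ _ → 0ℤ) ≡ 0ℤ
∑ˢ-0 S = cong₂ _-_ (∑ᴸ-0 (pos S)) (∑ᴸ-0 (neg S))

size≡∑ˢ-1 : ∀ (S : SSet A) → size S ≡ ∑ˢ S (λ _ → 1ℤ)
size≡∑ˢ-1 S = cong₂ _-_ (∑ᴸ-1 (pos S)) (∑ᴸ-1 (neg S))

∑ˢ-mapS : ∀ (g : A → B) (S : SSet A) f → ∑ˢ (mapS g S) f ≡ ∑ˢ S (f ∘ g)
∑ˢ-mapS g S f = cong₂ _-_ (∑ᴸ-map g (pos S) f) (∑ᴸ-map g (neg S) f)

size-restrict : ∀ (_≟_ : DecidableEquality B) (η : A → B) b (S : SSet A) →
  size (restrict _≟_ η b S) ≡ ∑ˢ S (λ s → 𝟙 (η s ≟ b))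
size-restrict _≟_ η b S = cong₂ _-_ (∑ᴸ-filter (λ s → η s ≟ b) (pos S)) (∑ᴸ-filter (λ s → η s ≟ b) (neg S))

∑ˢ-⨆ : ∀ (T : SSet A) (S : A → SSet B) f → ∑ˢ (⨆ T S) f ≡ ∑ˢ T (λ t → ∑ˢ (S t) f)
∑ˢ-⨆ T S f = begin
  ∑ˢ (⨆ T S) f
    ≡⟨ cong₂ _-_ (trans (∑ᴸ-++ (concatMap (pos ∘ S) (pos T)) _ f) (cong₂ _+_ (∑ᴸ-concatMap _ (pos T) f) (∑ᴸ-concatMap _ (neg T) f)))
                 (trans (∑ᴸ-++ (concatMap (neg ∘ S) (pos T)) _ f) (cong₂ _+_ (∑ᴸ-concatMap _ (pos T) f) (∑ᴸ-concatMap _ (neg T) f))) ⟩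
  (Σ⁺⁺ + Σ⁻⁻) - (Σ⁺⁻ + Σ⁻⁺)   ≡⟨ regroup-signs Σ⁺⁺ Σ⁻⁻ Σ⁺⁻ Σ⁻⁺ ⟩
  (Σ⁺⁺ - Σ⁺⁻) - (Σ⁻⁺ - Σ⁻⁻)   ≡⟨ sym (cong₂ _-_ (∑ᴸ-sub (pos T) _ _) (∑ᴸ-sub (neg T) _ _)) ⟩
  ∑ˢ T (λ t → ∑ˢ (S t) f)     ∎
  where
  open ≡-Reasoning
  Σ⁺⁺ = ∑ᴸ (pos T) (λ t → ∑ᴸ (pos (S t)) f)
  Σ⁺⁻ = ∑ᴸ (pos T) (λ t → ∑ᴸ (neg (S t)) f)
  Σ⁻⁺ = ∑ᴸ (neg T) (λ t → ∑ᴸ (pos (S t)) f)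
  Σ⁻⁻ = ∑ᴸ (neg T) (λ t → ∑ᴸ (neg (S t)) f)

∑ˢ-prodWith : ∀ (g : A → B → C) (S : SSet A) (T : SSet B) f → ∑ˢ (prodWith g S T) f ≡ ∑ˢ S (λ x → ∑ˢ T (f ∘ g x))
∑ˢ-prodWith g S T f = begin
  ∑ˢ (prodWith g S T) f
    ≡⟨ cong₂ _-_ (trans (∑ᴸ-++ (cartesianProductWith g (pos S) (pos T)) _ f)
                        (cong₂ _+_ (∑ᴸ-cartesianProductWith g (pos S) (pos T) f) (∑ᴸ-cartesianProductWith g (neg S) (neg T) f)))
                 (trans (∑ᴸ-++ (cartesianProductWith g (pos S) (neg T)) _ f)
                        (cong₂ _+_ (∑ᴸ-cartesianProductWith g (pos S) (neg T) f) (∑ᴸ-cartesianProductWith g (neg S) (pos T) f))) ⟩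
  (Σ⁺⁺ + Σ⁻⁻) - (Σ⁺⁻ + Σ⁻⁺)   ≡⟨ regroup-signs Σ⁺⁺ Σ⁻⁻ Σ⁺⁻ Σ⁻⁺ ⟩
  (Σ⁺⁺ - Σ⁺⁻) - (Σ⁻⁺ - Σ⁻⁻)   ≡⟨ sym (cong₂ _-_ (∑ᴸ-sub (pos S) _ _) (∑ᴸ-sub (neg S) _ _)) ⟩
  ∑ˢ S (λ x → ∑ˢ T (f ∘ g x)) ∎
  where
  open ≡-Reasoning
  Σ⁺⁺ = ∑ᴸ (pos S) (λ x → ∑ᴸ (pos T) (f ∘ g x))
  Σ⁺⁻ = ∑ᴸ (pos S) (λ x → ∑ᴸ (neg T) (f ∘ g x))
  Σ⁻⁺ = ∑ᴸ (neg S) (λ x → ∑ᴸ (pos T) (f ∘ g x))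
  Σ⁻⁻ = ∑ᴸ (neg S) (λ x → ∑ᴸ (neg T) (f ∘ g x))

∑ᴸ-range-telescope : ∀ a n (G : ℤ → ℤ) → ∑ᴸ (range a n) (λ x → G (x + 1ℤ) - G x) ≡ G (a + + n) - G a
∑ᴸ-range-telescope a zero    G = trans (sym (ℤP.+-inverseʳ (G a))) (cong (λ t → G t - G a) (sym (ℤP.+-identityʳ a)))
∑ᴸ-range-telescope a (suc n) G =
  trans (cong (λ t → G (a + 1ℤ) - G a + t) (∑ᴸ-range-telescope (a + 1ℤ) n G))
        (trans (chain (G (a + 1ℤ)) (G a) (G (a + 1ℤ + + n))) (cong (λ t → G t - G a) (ℤP.+-assoc a 1ℤ (+ n))))
  where
  chain : ∀ p q r → p - q + (r - p) ≡ r - q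
  chain = solve-∀

∑ˢ-interval-telescope : ∀ a b (G : ℤ → ℤ) → ∑ˢ (interval a b) (λ x → G (x + 1ℤ) - G x) ≡ G b - G a
∑ˢ-interval-telescope a b G with b - a in b-a≡
... | + zero   = trans (sym (ℤP.+-inverseʳ (G a))) (cong (λ t → G t - G a) a≡b)
  where
  a≡b : a ≡ b
  a≡b = trans (sym (ℤP.+-identityʳ a)) (trans (cong (λ t → a + t) (sym b-a≡)) (a+[b-a]≡b a b))
... | + suc m  =
  trans (ℤP.+-identityʳ _) (trans (∑ᴸ-range-telescope a (suc m) G)
    (cong (λ t → G t - G a) (trans (cong (λ t → a + t) (sym b-a≡)) (a+[b-a]≡b a b))))
... | -[1+ m ] =
  trans (cong (λ t → 0ℤ - t) (∑ᴸ-range-telescope b (suc m) G))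
    (trans (flip (G (b + + suc m)) (G b)) (cong (λ t → G b - G t) (trans (cong (λ d → b + - d) (sym b-a≡)) (b-[b-a]≡a a b))))
  where
  flip : ∀ p q → 0ℤ - (p - q) ≡ q - p
  flip = solve-∀
  b-[b-a]≡a : ∀ a b → b + - (b - a) ≡ a
  b-[b-a]≡a = solve-∀

-- Summing rows over a box

consecutive : (A → A → B) → List A → List B
consecutive f []           = []
consecutive f (a ∷ [])     = []
consecutive f (a ∷ b ∷ as) = f a b ∷ consecutive f (b ∷ as)

length-consecutive : ∀ (f : A → A → B) as → length (consecutive f as) ≡ ℕ.pred (length as)
length-consecutive f []           = refl
length-consecutive f (a ∷ [])     = refl
length-consecutive f (a ∷ b ∷ as) = cong suc (length-consecutive f (b ∷ as))

map-consecutive : ∀ (h : B → C) (f : A → A → B) as → map h (consecutive f as) ≡ consecutive (λ a b → h (f a b)) as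
map-consecutive h f []           = refl
map-consecutive h f (a ∷ [])     = refl
map-consecutive h f (a ∷ b ∷ as) = cong (h (f a b) ∷_) (map-consecutive h f (b ∷ as))

consecutive-pointwise : ∀ {_∼_ : B → B → Set} {f g : A → A → B} → (∀ a b → f a b ∼ g a b) →
  ∀ as → Pointwise _∼_ (consecutive f as) (consecutive g as)
consecutive-pointwise f∼g []           = []
consecutive-pointwise f∼g (a ∷ [])     = []
consecutive-pointwise f∼g (a ∷ b ∷ as) = f∼g a b ∷ consecutive-pointwise f∼g (b ∷ as)

consecutive-pointwise-linked : ∀ {P : A → A → Set} {_∼_ : B → B → Set} {f g : A → A → B} →
  (∀ {a b} → P a b → f a b ∼ g a b) → ∀ {as} → Linked P as → Pointwise _∼_ (consecutive f as) (consecutive g as)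
consecutive-pointwise-linked f∼g []          = []
consecutive-pointwise-linked f∼g [-]         = []
consecutive-pointwise-linked f∼g (Pab ∷ ↗) = f∼g Pab ∷ consecutive-pointwise-linked f∼g ↗

det-∑ᴸ : ∀ (pre : List Row) (xs : List A) (R : A → Row) post →
  ∑ᴸ xs (λ x → det (pre ++ R x ∷ post)) ≡ det (pre ++ (λ c → ∑ᴸ xs (λ x → R x c)) ∷ post)
det-∑ᴸ pre []       R post = sym (det-zero-row pre _ post (λ _ → refl))
det-∑ᴸ pre (x ∷ xs) R post =
  trans (cong (λ t → det (pre ++ R x ∷ post) + t) (det-∑ᴸ pre xs R post))
    (sym (trans (det-linear pre _ (R x) (λ c → ∑ᴸ xs (λ y → R y c)) post 1ℤ 1ℤ
                  (λ c → sym (cong₂ _+_ (ℤP.*-identityˡ (R x c)) (ℤP.*-identityˡ _))))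
                (cong₂ _+_ (ℤP.*-identityˡ (det (pre ++ R x ∷ post)))
                           (ℤP.*-identityˡ (det (pre ++ (λ c → ∑ᴸ xs (λ y → R y c)) ∷ post))))))

det-∑ˢ : ∀ (pre : List Row) (S : SSet A) (R : A → Row) post →
  ∑ˢ S (λ x → det (pre ++ R x ∷ post)) ≡ det (pre ++ (λ c → ∑ˢ S (λ x → R x c)) ∷ post)
det-∑ˢ pre S R post =
  trans (cong₂ _-_ (det-∑ᴸ pre (pos S) R post) (det-∑ᴸ pre (neg S) R post))
    (sym (trans (det-linear pre _ row⁺ row⁻ post 1ℤ (- 1ℤ) (λ c → difference (row⁺ c) (row⁻ c)))
                (sym (difference (det (pre ++ row⁺ ∷ post)) (det (pre ++ row⁻ ∷ post))))))
  where
  row⁺ row⁻ : Row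
  row⁺ c = ∑ᴸ (pos S) (λ x → R x c)
  row⁻ c = ∑ᴸ (neg S) (λ x → R x c)
  difference : ∀ x y → x - y ≡ 1ℤ * x + (- 1ℤ) * y
  difference = solve-∀

intervalRow : (ℤ → Row) → ℤ → ℤ → Row
intervalRow R a b c = ∑ˢ (interval a b) (λ x → R x c)

∑ˢ-intervals-det : ∀ n (k : Vec ℤ (suc (suc n))) (R : ℤ → Row) (pre : List Row) →
  ∑ˢ (intervals k) (λ l → det (pre ++ map R (toList l))) ≡ det (pre ++ consecutive (intervalRow R) (toList k))
∑ˢ-intervals-det zero    (a ∷ b ∷ [])   R pre =
  trans (∑ˢ-mapS (λ x → x ∷ []) (interval a b) _) (det-∑ˢ pre (interval a b) R [])
∑ˢ-intervals-det (suc n) (a ∷ b ∷ rest) R pre =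
  trans (∑ˢ-prodWith _∷_ (interval a b) (intervals (b ∷ rest)) _)
   (trans (∑ˢ-cong (interval a b) (λ x →
            trans (∑ˢ-cong (intervals (b ∷ rest)) (λ l → cong det (sym (LP.∷ʳ-++ pre (R x) (map R (toList l))))))
             (trans (∑ˢ-intervals-det n (b ∷ rest) R (pre ∷ʳ R x))
                    (cong det (LP.∷ʳ-++ pre (R x) (consecutive (intervalRow R) (toList (b ∷ rest))))))))
          (det-∑ˢ pre (interval a b) R (consecutive (intervalRow R) (toList (b ∷ rest)))))

differenceRow : (ℤ → Row) → ℤ → ℤ → Row
differenceRow E a b c = E b c - E a c

-- Subtracting from each row its predecessor clears the first column, which is constantly 1.
det-differences : ∀ (E : ℤ → Row) → (∀ x → E x 0 ≡ 1ℤ) → ∀ as →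
  det (map E as) ≡ det (consecutive (λ a b → differenceRow E a b ∘ suc) as)
det-differences E E₀≡1 []       = refl
det-differences E E₀≡1 (a ∷ as) = begin
  det (map E (a ∷ as))                                        ≡⟨ subtract-predecessors [] a as ⟩
  det (E a ∷ consecutive (differenceRow E) (a ∷ as))          ≡⟨ det-∷-zero-column (E a) _ (first-column-zero a as) ⟩
  E a 0 * det (map (_∘ suc) (consecutive (differenceRow E) (a ∷ as)))
    ≡⟨ cong₂ _*_ (E₀≡1 a) (cong det (map-consecutive (_∘ suc) (differenceRow E) (a ∷ as))) ⟩
  1ℤ * det (consecutive (λ a b → differenceRow E a b ∘ suc) (a ∷ as))
    ≡⟨ ℤP.*-identityˡ _ ⟩
  det (consecutive (λ a b → differenceRow E a b ∘ suc) (a ∷ as)) ∎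
  where
  open ≡-Reasoning
  subtract-predecessors : ∀ pre a as → det (pre ++ map E (a ∷ as)) ≡ det (pre ++ E a ∷ consecutive (differenceRow E) (a ∷ as))
  subtract-predecessors pre a []       = refl
  subtract-predecessors pre a (b ∷ as) =
    trans (cong det (sym (LP.∷ʳ-++ pre (E a) (map E (b ∷ as)))))
     (trans (subtract-predecessors (pre ∷ʳ E a) b as)
       (trans (cong det (LP.∷ʳ-++ pre (E a) (E b ∷ consecutive (differenceRow E) (b ∷ as))))
              (det-subtract-earlier pre (E a) [] (E b) (consecutive (differenceRow E) (b ∷ as)))))
  first-column-zero : ∀ a as → All (λ v → v 0 ≡ 0ℤ) (consecutive (differenceRow E) (a ∷ as))
  first-column-zero a []       = []
  first-column-zero a (b ∷ as) = trans (cong₂ _-_ (E₀≡1 b) (E₀≡1 a)) refl ∷ first-column-zero b as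

-- Sorting the rows

private
  module ∨-CS = CommutativeSemigroupProperties (CommutativeMonoid.commutativeSemigroup BoolP.∨-commutativeMonoid)

insertionSort≡sort : ∀ xs → insertionSort xs ≡ sort xs
insertionSort≡sort xs = Pointwise-≡⇒≡ (SortedP.↗↭↗⇒≋ ℤP.≤-totalOrder (InsertionSortP.sort-↗ xs) (sort-↗ xs)
  (↭⇒↭ₛ (↭-trans (InsertionSortP.sort-↭ xs) (↭-sym (sort-↭ xs)))))

countBelow : ℤ → List ℤ → ℕ
countBelow x ys = length (filter (λ y → y ℤ.<? x) ys)

countBelow-↭ : ∀ x {ys zs} → ys ↭ zs → countBelow x ys ≡ countBelow x zs
countBelow-↭ x ys↭zs = ↭-length (filter-↭ (λ y → y ℤ.<? x) ys↭zs)

det-insert : ∀ (R : ℤ → Row) pre x ys → Sorted ys →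
  det (pre ++ R x ∷ map R ys) ≡ (- 1ℤ) ^ countBelow x ys * det (pre ++ map R (insert x ys))
det-insert R pre x []       _  = sym (ℤP.*-identityˡ _)
det-insert R pre x (y ∷ ys) y∷ys↗ with x ℤ.≤? y
... | yes x≤y = sym (trans (cong (λ n → (- 1ℤ) ^ n * det (pre ++ R x ∷ R y ∷ map R ys)) none-below) (ℤP.*-identityˡ _))
  where
  none-below : countBelow x (y ∷ ys) ≡ 0
  none-below = cong length (LP.filter-none (λ y → y ℤ.<? x) (All.map ℤP.≤⇒≯ (LinkedP.Linked⇒All ℤP.≤-trans x≤y y∷ys↗)))
... | no x≰y with y ℤ.<? x
...   | no y≮x = ⊥-elim (y≮x (ℤP.≰⇒> x≰y))
...   | yes _  = begin
  det (pre ++ R x ∷ R y ∷ map R ys)                          ≡⟨ det-swap pre (R x) (R y) (map R ys) ⟩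
  - det (pre ++ R y ∷ R x ∷ map R ys)                        ≡⟨ cong (λ rs → - det rs) (sym (LP.∷ʳ-++ pre (R y) _)) ⟩
  - det (pre ∷ʳ R y ++ R x ∷ map R ys)                       ≡⟨ cong -_ (det-insert R (pre ∷ʳ R y) x ys (Linked.tail y∷ys↗)) ⟩
  - (s * det (pre ∷ʳ R y ++ map R (insert x ys)))            ≡⟨ cong (λ rs → - (s * det rs)) (LP.∷ʳ-++ pre (R y) _) ⟩
  - (s * det (pre ++ R y ∷ map R (insert x ys)))             ≡⟨ ℤP.neg-distribˡ-* s _ ⟩
  - s * det (pre ++ R y ∷ map R (insert x ys))               ≡⟨ cong (_* det (pre ++ R y ∷ map R (insert x ys))) (ℤP.-1*i≡-i s) ⟨
  - 1ℤ * s * det (pre ++ R y ∷ map R (insert x ys))          ∎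
  where
  open ≡-Reasoning
  s = (- 1ℤ) ^ countBelow x ys

det-insertionSort : ∀ (R : ℤ → Row) pre xs →
  det (pre ++ map R xs) ≡ (- 1ℤ) ^ inversions xs * det (pre ++ map R (insertionSort xs))
det-insertionSort R pre []       = sym (ℤP.*-identityˡ _)
det-insertionSort R pre (x ∷ xs) = begin
  det (pre ++ R x ∷ map R xs)                        ≡⟨ cong det (sym (LP.∷ʳ-++ pre (R x) _)) ⟩
  det (pre ∷ʳ R x ++ map R xs)                       ≡⟨ det-insertionSort R (pre ∷ʳ R x) xs ⟩
  t * det (pre ∷ʳ R x ++ map R (insertionSort xs))   ≡⟨ cong (λ rs → t * det rs) (LP.∷ʳ-++ pre (R x) _) ⟩
  t * det (pre ++ R x ∷ map R (insertionSort xs))    ≡⟨ cong (t *_) (det-insert R pre x (insertionSort xs) (InsertionSortP.sort-↗ xs)) ⟩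
  t * ((- 1ℤ) ^ countBelow x (insertionSort xs) * d) ≡⟨ cong (λ n → t * ((- 1ℤ) ^ n * d)) (countBelow-↭ x (InsertionSortP.sort-↭ xs)) ⟩
  t * ((- 1ℤ) ^ countBelow x xs * d)                 ≡⟨ regroup t ((- 1ℤ) ^ countBelow x xs) d ⟩
  (- 1ℤ) ^ countBelow x xs * t * d                   ≡⟨ cong (_* d) (ℤP.^-distribˡ-+-* (- 1ℤ) (countBelow x xs) (inversions xs)) ⟨
  (- 1ℤ) ^ inversions (x ∷ xs) * d                   ∎
  where
  open ≡-Reasoning
  t = (- 1ℤ) ^ inversions xs
  d = det (pre ++ map R (insertionSort (x ∷ xs)))
  regroup : ∀ a b c → a * (b * c) ≡ b * a * c
  regroup = solve-∀

occurs-↭ : ∀ x {ys zs} → ys ↭ zs → occurs x ys ≡ occurs x zs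
occurs-↭ x ↭.refl                = refl
occurs-↭ x (↭.prep y ys↭zs)      = cong (does (x ℤ.≟ y) ∨_) (occurs-↭ x ys↭zs)
occurs-↭ x (↭.swap y z ys↭zs)    =
  trans (∨-CS.x∙yz≈y∙xz (does (x ℤ.≟ y)) (does (x ℤ.≟ z)) _)
        (cong (λ b → does (x ℤ.≟ z) ∨ (does (x ℤ.≟ y) ∨ b)) (occurs-↭ x ys↭zs))
occurs-↭ x (↭.trans ys↭zs zs↭ws) = trans (occurs-↭ x ys↭zs) (occurs-↭ x zs↭ws)

hasTie-↭ : ∀ {ys zs} → ys ↭ zs → hasTie ys ≡ hasTie zs
hasTie-↭ ↭.refl                = refl
hasTie-↭ (↭.prep y ys↭zs)      = cong₂ _∨_ (occurs-↭ y ys↭zs) (hasTie-↭ ys↭zs)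
hasTie-↭ (↭.swap {ys} {zs} y z ys↭zs) = begin
  (does (y ℤ.≟ z) ∨ occurs y ys) ∨ (occurs z ys ∨ hasTie ys)
    ≡⟨ ∨-CS.interchange (does (y ℤ.≟ z)) _ _ _ ⟩
  (does (y ℤ.≟ z) ∨ occurs z ys) ∨ (occurs y ys ∨ hasTie ys)
    ≡⟨ cong₂ (λ b c → (b ∨ occurs z ys) ∨ (occurs y ys ∨ c)) ≟-sym (hasTie-↭ ys↭zs) ⟩
  (does (z ℤ.≟ y) ∨ occurs z ys) ∨ (occurs y ys ∨ hasTie zs)
    ≡⟨ cong₂ (λ b c → (does (z ℤ.≟ y) ∨ b) ∨ (c ∨ hasTie zs)) (occurs-↭ z ys↭zs) (occurs-↭ y ys↭zs) ⟩
  (does (z ℤ.≟ y) ∨ occurs z zs) ∨ (occurs y zs ∨ hasTie zs) ∎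
  where
  open ≡-Reasoning
  ≟-sym : does (y ℤ.≟ z) ≡ does (z ℤ.≟ y)
  ≟-sym = does-⇔ (mk⇔ sym sym) (y ℤ.≟ z) (z ℤ.≟ y)
hasTie-↭ (↭.trans ys↭zs zs↭ws) = trans (hasTie-↭ ys↭zs) (hasTie-↭ zs↭ws)

split-at-occurrence : ∀ x xs → occurs x xs ≡ true → Σ[ mid ∈ List ℤ ] Σ[ post ∈ List ℤ ] xs ≡ mid ++ x ∷ post
split-at-occurrence x (y ∷ ys) x∈y∷ys with x ℤ.≟ y
... | yes refl = [] , ys , refl
... | no _ with mid , post , refl ← split-at-occurrence x ys x∈y∷ys = y ∷ mid , post , refl

det-tie : ∀ (R : ℤ → Row) pre xs → hasTie xs ≡ true → det (pre ++ map R xs) ≡ 0ℤ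
det-tie R pre (x ∷ xs) tie with occurs x xs in x∈xs
... | true with mid , post , refl ← split-at-occurrence x xs x∈xs =
  trans (cong (λ rs → det (pre ++ R x ∷ rs)) (LP.map-++ R mid (x ∷ post)))
          (det-repeated pre (R x) (map R mid) (R x) (map R post) (λ _ → refl))
... | false = trans (cong det (sym (LP.∷ʳ-++ pre (R x) (map R xs)))) (det-tie R (pre ∷ʳ R x) xs tie)

sgnL-tie : ∀ xs → hasTie xs ≡ true → sgnL xs ≡ 0ℤ
sgnL-tie xs tie rewrite tie = refl

det-sort : ∀ (R : ℤ → Row) xs → det (map R xs) ≡ sgnL xs * det (map R (sort xs))
det-sort R xs with hasTie xs in tie
... | true  = det-tie R [] xs tie
... | false = trans (det-insertionSort R [] xs) (cong (λ ys → (- 1ℤ) ^ inversions xs * det (map R ys)) (insertionSort≡sort xs))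

-- Falling factorials and the Vandermonde determinant

falling : ℤ → ℕ → ℤ
falling x zero    = 1ℤ
falling x (suc i) = falling x i * (x - + i)

falling-difference : ∀ x i → falling (x + 1ℤ) (suc i) - falling x (suc i) ≡ + suc i * falling x i
falling-difference x i = trans (cong (_- falling x (suc i)) (shifted x i)) (difference (falling x i) x (+ i))
  where
  swap : ∀ y → 1ℤ * (y - 0ℤ) ≡ y * 1ℤ
  swap = solve-∀
  shifted : ∀ x i → falling (x + 1ℤ) (suc i) ≡ (x + 1ℤ) * falling x i
  shifted x zero    = swap (x + 1ℤ)
  shifted x (suc i) = trans (cong (_* (x + 1ℤ - + suc i)) (shifted x i)) (regroup x (falling x i) (+ i))
    where
    regroup : ∀ x f p → (x + 1ℤ) * f * (x + 1ℤ - (1ℤ + p)) ≡ (x + 1ℤ) * (f * (x - p))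
    regroup = solve-∀
  difference : ∀ f x p → (x + 1ℤ) * f - f * (x - p) ≡ (1ℤ + p) * f
  difference = solve-∀

falling-interval : ∀ a b i → falling b (suc i) - falling a (suc i) ≡ + suc i * ∑ˢ (interval a b) (λ x → falling x i)
falling-interval a b i = sym (trans (sym (*-distribˡ-∑ˢ (interval a b) (+ suc i) (λ x → falling x i)))
  (trans (∑ˢ-cong (interval a b) (λ x → sym (falling-difference x i))) (∑ˢ-interval-telescope a b (λ x → falling x (suc i)))))

vandermonde : List ℤ → ℤ
vandermonde []       = 1ℤ
vandermonde (x ∷ xs) = ∏ᴸ (map (λ y → y - x) xs) * vandermonde xs

-- dividedFalling i (x ∷ z) is the divided difference of y ↦ falling y (i + length z) at the nodes x ∷ z.
dividedFalling : ℕ → List ℤ → ℤ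
dividedFalling zero    _       = 1ℤ
dividedFalling (suc i) []      = 0ℤ
dividedFalling (suc i) (x ∷ z) = dividedFalling (suc i) z + (x - + (i ℕ.+ length z)) * dividedFalling i (x ∷ z)

dividedFalling-difference : ∀ i x y z →
  dividedFalling (suc i) (x ∷ z) - dividedFalling (suc i) (y ∷ z) ≡ (x - y) * dividedFalling i (x ∷ y ∷ z)
dividedFalling-difference zero    x y z = base x y (dividedFalling 1 z) (+ length z)
  where
  base : ∀ x y f L → f + (x - L) * 1ℤ - (f + (y - L) * 1ℤ) ≡ (x - y) * 1ℤ
  base = solve-∀
dividedFalling-difference (suc i) x y z = begin
  F (suc (suc i)) z + (x - s) * F (suc i) (x ∷ z) - (F (suc (suc i)) z + (y - s) * F (suc i) (y ∷ z))
    ≡⟨ cong (λ t → F (suc (suc i)) z + (x - s) * t - (F (suc (suc i)) z + (y - s) * F (suc i) (y ∷ z)))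
            (trans (split (F (suc i) (x ∷ z)) (F (suc i) (y ∷ z))) (cong (_+ F (suc i) (y ∷ z)) (dividedFalling-difference i x y z))) ⟩
  F (suc (suc i)) z + (x - s) * ((x - y) * F i (x ∷ y ∷ z) + F (suc i) (y ∷ z)) - (F (suc (suc i)) z + (y - s) * F (suc i) (y ∷ z))
    ≡⟨ regroup x y s (F (suc (suc i)) z) (F (suc i) (y ∷ z)) (F i (x ∷ y ∷ z)) ⟩
  (x - y) * (F (suc i) (y ∷ z) + (x - s) * F i (x ∷ y ∷ z))
    ≡⟨ cong (λ n → (x - y) * (F (suc i) (y ∷ z) + (x - + n) * F i (x ∷ y ∷ z))) (sym (ℕP.+-suc i (length z))) ⟩
  (x - y) * F (suc i) (x ∷ y ∷ z) ∎
  where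
  open ≡-Reasoning
  F = dividedFalling
  s = + (suc i ℕ.+ length z)
  split : ∀ a b → a ≡ (a - b) + b
  split = solve-∀
  regroup : ∀ x y s G B C → G + (x - s) * ((x - y) * C + B) - (G + (y - s) * B) ≡ (x - y) * (B + (x - s) * C)
  regroup = solve-∀

dividedFallingRow : List ℤ → ℤ → Row
dividedFallingRow z x c = dividedFalling c (x ∷ z)

-- Subtracting the first row and factoring out x - x₀ turns the rows at nodes z into the rows at nodes x₀ ∷ z.
det-dividedFalling : ∀ xs z → det (map (dividedFallingRow z) xs) ≡ vandermonde xs
det-dividedFalling []        z = refl
det-dividedFalling (x₀ ∷ xs) z = begin
  det (map (dividedFallingRow z) (x₀ ∷ xs))
    ≡⟨ det-subtract-first (dividedFallingRow z x₀) (dividedFallingRow z) xs ⟩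
  det (dividedFallingRow z x₀ ∷ map D xs)
    ≡⟨ det-∷-zero-column (dividedFallingRow z x₀) (map D xs) (zero-column xs) ⟩
  1ℤ * det (map (_∘ suc) (map D xs))
    ≡⟨ ℤP.*-identityˡ _ ⟩
  det (map (_∘ suc) (map D xs))
    ≡⟨ cong det (sym (LP.map-∘ xs)) ⟩
  det (map (λ x → D x ∘ suc) xs)
    ≡⟨ det-scale-rows [] (λ x → x - x₀) (λ x c → dividedFalling-difference c x x₀ z) xs ⟩
  ∏ᴸ (map (λ x → x - x₀) xs) * det (map (dividedFallingRow (x₀ ∷ z)) xs)
    ≡⟨ cong (∏ᴸ (map (λ x → x - x₀) xs) *_) (det-dividedFalling xs (x₀ ∷ z)) ⟩
  vandermonde (x₀ ∷ xs) ∎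
  where
  open ≡-Reasoning
  D : ℤ → Row
  D x c = dividedFallingRow z x c - dividedFallingRow z x₀ c
  zero-column : ∀ xs → All (λ v → v 0 ≡ 0ℤ) (map D xs)
  zero-column []       = []
  zero-column (x ∷ xs) = refl ∷ zero-column xs

det-falling : ∀ xs → det (map falling xs) ≡ vandermonde xs
det-falling xs = trans (det-map-cong (λ x i → sym (dividedFalling-single x i)) xs) (det-dividedFalling xs [])
  where
  dividedFalling-single : ∀ x i → dividedFalling i (x ∷ []) ≡ falling x i
  dividedFalling-single x zero    = refl
  dividedFalling-single x (suc i) =
    trans (cong₂ (λ n f → 0ℤ + (x - + n) * f) (ℕP.+-identityʳ i) (dividedFalling-single x i))
          (trans (ℤP.+-identityˡ _) (ℤP.*-comm (x - + i) (falling x i)))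

rising : ℕ → ℕ → ℕ
rising d zero    = 1
rising d (suc n) = suc d ℕ.* rising (suc d) n

superfactorial : ℕ → ℕ
superfactorial zero    = 1
superfactorial (suc m) = rising 0 (suc m) ℕ.* superfactorial m

rising-nonZero : ∀ d n → NonZero (rising d n)
rising-nonZero d zero    = _
rising-nonZero d (suc n) = ℕP.m*n≢0 (suc d) (rising (suc d) n) {{_}} {{rising-nonZero (suc d) n}}

superfactorial-nonZero : ∀ m → NonZero (superfactorial m)
superfactorial-nonZero zero    = _
superfactorial-nonZero (suc m) = ℕP.m*n≢0 (rising 0 (suc m)) (superfactorial m) {{rising-nonZero 0 (suc m)}} {{superfactorial-nonZero m}}

∏<-rising : ∀ d n → ∏< n (λ c → + suc (d ℕ.+ c)) ≡ + rising d n
∏<-rising d zero    = refl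
∏<-rising d (suc n) =
  trans (cong₂ _*_ (cong (λ e → + suc e) (ℕP.+-identityʳ d))
                   (trans (∏<-cong n (λ c → cong (λ e → + suc e) (ℕP.+-suc d c))) (∏<-rising (suc d) n)))
        (sym (ℤP.pos-* (suc d) (rising (suc d) n)))

size-GT-suc : ∀ m (k : Vec ℤ (suc (suc m))) → size (GT (suc m) k) ≡ ∑ˢ (intervals k) (λ l → size (GT m l))
size-GT-suc m k =
  trans (size≡∑ˢ-1 (GT (suc m) k))
   (trans (∑ˢ-⨆ (intervals k) _ _)
     (∑ˢ-cong (intervals k) (λ l → trans (∑ˢ-mapS _ (GT m l) _) (sym (size≡∑ˢ-1 (GT m l))))))

det-falling≡size-GT : ∀ m (k : Vec ℤ (suc m)) → det (map falling (toList k)) ≡ + superfactorial m * size (GT m k)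
det-falling≡size-GT zero    (a ∷ [])   = refl
det-falling≡size-GT (suc m) k@(a ∷ rest) = begin
  det (map falling ks)
    ≡⟨ det-differences falling (λ _ → refl) ks ⟩
  det (consecutive (λ a b → differenceRow falling a b ∘ suc) ks)
    ≡⟨ det-scale-columns (consecutive-pointwise (λ a b c → falling-interval a b c) ks) ⟩
  ∏< (length (consecutive (intervalRow falling) ks)) (λ c → + suc c) * det (consecutive (intervalRow falling) ks)
    ≡⟨ cong₂ (λ n d → ∏< n (λ c → + suc c) * d) length-rows (sym (∑ˢ-intervals-det m k falling [])) ⟩
  ∏< (suc m) (λ c → + suc c) * ∑ˢ (intervals k) (λ l → det (map falling (toList l)))
    ≡⟨ cong₂ _*_ (∏<-rising 0 (suc m)) (∑ˢ-cong (intervals k) (λ l → det-falling≡size-GT m l)) ⟩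
  + rising 0 (suc m) * ∑ˢ (intervals k) (λ l → + superfactorial m * size (GT m l))
    ≡⟨ cong (+ rising 0 (suc m) *_) (*-distribˡ-∑ˢ (intervals k) (+ superfactorial m) (λ l → size (GT m l))) ⟩
  + rising 0 (suc m) * (+ superfactorial m * ∑ˢ (intervals k) (λ l → size (GT m l)))
    ≡⟨ sym (ℤP.*-assoc (+ rising 0 (suc m)) _ _) ⟩
  + rising 0 (suc m) * + superfactorial m * ∑ˢ (intervals k) (λ l → size (GT m l))
    ≡⟨ cong₂ _*_ (sym (ℤP.pos-* (rising 0 (suc m)) (superfactorial m))) (sym (size-GT-suc m k)) ⟩
  + superfactorial (suc m) * size (GT (suc m) k) ∎
  where
  open ≡-Reasoning
  ks = toList k
  length-rows : length (consecutive (intervalRow falling) ks) ≡ suc m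
  length-rows = trans (length-consecutive (intervalRow falling) ks) (cong ℕ.pred (VP.length-toList k))

size-GT-sort : ∀ m (k k′ : Vec ℤ (suc m)) → toList k′ ≡ sort (toList k) → size (GT m k) ≡ sgn k * size (GT m k′)
size-GT-sort m k k′ k′≡sort[k] = ℤP.*-cancelˡ-≡ (+ superfactorial m) _ _ {{superfactorial-nonZero m}} (begin
  + superfactorial m * size (GT m k)          ≡⟨ det-falling≡size-GT m k ⟨
  det (map falling (toList k))             ≡⟨ det-sort falling (toList k) ⟩
  sgn k * det (map falling (sort (toList k)))
                                              ≡⟨ cong (λ xs → sgn k * det (map falling xs)) k′≡sort[k] ⟨
  sgn k * det (map falling (toList k′))    ≡⟨ cong (sgn k *_) (det-falling≡size-GT m k′) ⟩
  sgn k * (+ superfactorial m * size (GT m k′)) ≡⟨ swap (sgn k) (+ superfactorial m) (size (GT m k′)) ⟩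
  + superfactorial m * (sgn k * size (GT m k′)) ∎)
  where
  open ≡-Reasoning
  swap : ∀ a b c → a * (b * c) ≡ b * (a * c)
  swap = solve-∀

/-* : ∀ i j a b .{{_ : NonZero a}} .{{_ : NonZero b}} → (i / a) ℚ.* (j / b) ≡ ((i * j) / (a ℕ.* b)) {{ℕP.m*n≢0 a b}}
/-* i j (suc a) (suc b) =
  trans (sym (ℚP.fromℚᵘ-toℚᵘ (p ℚ.* q)))
   (ℚP.fromℚᵘ-cong (ℚᵘP.≃-trans (ℚP.toℚᵘ-homo-* p q)
      (ℚᵘP.*-cong (ℚP.toℚᵘ-fromℚᵘ (ℚᵘ.mkℚᵘ i a)) (ℚP.toℚᵘ-fromℚᵘ (ℚᵘ.mkℚᵘ j b)))))
  where
  p = i / suc a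
  q = j / suc b

/-cross : ∀ i j a b .{{_ : NonZero a}} .{{_ : NonZero b}} → i * + b ≡ j * + a → i / a ≡ j / b
/-cross i j (suc a) (suc b) ib≡ja = ℚP.fromℚᵘ-cong {ℚᵘ.mkℚᵘ i a} {ℚᵘ.mkℚᵘ j b} (ℚᵘ.*≡* ib≡ja)

prodRow≡/rising : ∀ x d ys → prodRow x d ys ≡ (∏ᴸ (map (λ y → y - x) ys) / rising d (length ys)) {{rising-nonZero d (length ys)}}
prodRow≡/rising x d []       = refl
prodRow≡/rising x d (y ∷ ys) =
  trans (cong (((y - x) / suc d) ℚ.*_) (prodRow≡/rising x (suc d) ys))
        (/-* (y - x) _ (suc d) (rising (suc d) (length ys)) {{_}} {{rising-nonZero (suc d) (length ys)}})

prodFormula≡vandermonde/superfactorial : ∀ m (k : Vec ℤ (suc m)) →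
  prodFormula (toList k) ≡ (vandermonde (toList k) / superfactorial m) {{superfactorial-nonZero m}}
prodFormula≡vandermonde/superfactorial zero    (x ∷ [])   = refl
prodFormula≡vandermonde/superfactorial (suc m) (x ∷ rest) = begin
  prodRow x 0 xs ℚ.* prodFormula xs
    ≡⟨ cong₂ ℚ._*_ (prodRow≡/rising x 0 xs) (prodFormula≡vandermonde/superfactorial m rest) ⟩
  (∏ᴸ (map (λ y → y - x) xs) / r) {{r≢0}} ℚ.* (vandermonde xs / superfactorial m) {{s≢0}}
    ≡⟨ /-* (∏ᴸ (map (λ y → y - x) xs)) (vandermonde xs) r (superfactorial m) {{r≢0}} {{s≢0}} ⟩
  (vandermonde (x ∷ xs) / (r ℕ.* superfactorial m)) {{ℕP.m*n≢0 r (superfactorial m) {{r≢0}} {{s≢0}}}}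
    ≡⟨ ℚP./-cong {vandermonde (x ∷ xs)} {{ℕP.m*n≢0 r (superfactorial m) {{r≢0}} {{s≢0}}}} {{superfactorial-nonZero (suc m)}} refl
                 (cong (λ n → rising 0 n ℕ.* superfactorial m) (VP.length-toList rest)) ⟩
  (vandermonde (x ∷ xs) / superfactorial (suc m)) {{superfactorial-nonZero (suc m)}} ∎
  where
  open ≡-Reasoning
  xs = toList rest
  r = rising 0 (length xs)
  r≢0 = rising-nonZero 0 (length xs)
  s≢0 = superfactorial-nonZero m

size-GT/1≡prodFormula : ∀ m (k : Vec ℤ (suc m)) → size (GT m k) / 1 ≡ prodFormula (toList k)
size-GT/1≡prodFormula m k =
  trans (/-cross (size (GT m k)) (vandermonde (toList k)) 1 (superfactorial m) {{_}} {{superfactorial-nonZero m}} cross)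
        (sym (prodFormula≡vandermonde/superfactorial m k))
  where
  cross : size (GT m k) * + superfactorial m ≡ vandermonde (toList k) * 1ℤ
  cross = trans (ℤP.*-comm (size (GT m k)) _)
    (trans (sym (det-falling≡size-GT m k)) (trans (det-falling (toList k)) (sym (ℤP.*-identityʳ _))))

-- Interlacing

_≟ᴸ_ : (xs ys : List ℤ) → Dec (xs ≡ ys)
_≟ᴸ_ = LP.≡-dec ℤ._≟_

Strict : List ℤ → Set
Strict = Linked _<_

Interlace? : ∀ r r′ → Dec (Interlace r r′)
Interlace? []       _             = yes tt
Interlace? (a ∷ as) []            = no λ ()
Interlace? (a ∷ as) (b ∷ [])      = no λ ()
Interlace? (a ∷ as) (b ∷ b′ ∷ bs) = ((b ℤ.≤? a) ×-dec (a ℤ.<? b′)) ×-dec Interlace? as (b′ ∷ bs)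

along : (ℤ → ℤ) → List ℤ → Row
along f []       i       = 0ℤ
along f (b ∷ bs) zero    = f b
along f (b ∷ bs) (suc i) = along f bs i

along-zero : ∀ {f B} → All (λ b → f b ≡ 0ℤ) B → ∀ i → along f B i ≡ 0ℤ
along-zero []          i       = refl
along-zero (fb≡0 ∷ _)  zero    = fb≡0
along-zero (_ ∷ all≡0) (suc i) = along-zero all≡0 i

δRow : List ℤ → ℤ → Row
δRow B x = along (λ b → 𝟙 (x ℤ.≟ b)) B

private
  All-<-≤ : ∀ {x y} {cs : List ℤ} → x < y → All (y ≤_) cs → All (x <_) cs
  All-<-≤ x<y = All.map (ℤP.<-≤-trans x<y)

  strict-head : ∀ {b bs} → Strict (b ∷ bs) → All (b <_) bs
  strict-head [-]            = []
  strict-head (b<b′ ∷ ↗) = LinkedP.Linked⇒All ℤP.<-trans b<b′ ↗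

  sorted-head : ∀ {c cs} → Sorted (c ∷ cs) → All (c ≤_) cs
  sorted-head [-]            = []
  sorted-head (c≤c′ ∷ ↗) = LinkedP.Linked⇒All ℤP.≤-trans c≤c′ ↗

sorted-head-split : ∀ c cs → Sorted (c ∷ cs) → All (c <_) cs ⊎ Σ[ cs′ ∈ List ℤ ] cs ≡ c ∷ cs′
sorted-head-split c []        _ = inj₁ []
sorted-head-split c (c′ ∷ cs) c∷cs↗ with c′ ℤ.≟ c
... | yes refl = inj₂ (cs , refl)
... | no c′≢c  = inj₁ (c<c′ ∷ All-<-≤ c<c′ (sorted-head (Linked.tail c∷cs↗)))
  where
  c<c′ : c < c′
  c<c′ = ℤP.≤∧≢⇒< (Linked.head c∷cs↗) (c′≢c ∘ sym)

<⇒+1≤ : ∀ {x y} → x < y → x + 1ℤ ≤ y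
<⇒+1≤ {x} {y} x<y = subst (_≤ y) (ℤP.+-comm 1ℤ x) (ℤP.i<j⇒suc[i]≤j x<y)

+1≤⇒< : ∀ {x y} → x + 1ℤ ≤ y → x < y
+1≤⇒< {x} {y} x+1≤y = ℤP.suc[i]≤j⇒i<j (subst (_≤ y) (ℤP.+-comm x 1ℤ) x+1≤y)

𝟙-≟-< : ∀ {x y} → x < y → 𝟙 (x ℤ.≟ y) ≡ 0ℤ
𝟙-≟-< x<y = 𝟙-no (_ ℤ.≟ _) (λ x≡y → ℤP.<-irrefl x≡y x<y)

𝟙-≟-> : ∀ {x y} → y < x → 𝟙 (x ℤ.≟ y) ≡ 0ℤ
𝟙-≟-> y<x = 𝟙-no (_ ℤ.≟ _) (λ x≡y → ℤP.<-irrefl (sym x≡y) y<x)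

δRows-first-column : ∀ {b} bs {cs} → All (b <_) cs → All (λ v → v 0 ≡ 0ℤ) (map (δRow (b ∷ bs)) cs)
δRows-first-column bs []            = []
δRows-first-column bs (b<c ∷ b<cs) = 𝟙-≟-> b<c ∷ δRows-first-column bs b<cs

det-δRows : ∀ B c → Strict B → Sorted c → length c ≡ length B → det (map (δRow B) c) ≡ 𝟙 (B ≟ᴸ c)
det-δRows []       []       _  _  _   = refl
det-δRows (b ∷ bs) (c ∷ cs) B↗ c↗ len with ℤP.<-cmp c b
... | tri< c<b _ _ =
  trans (det-zero-row [] (δRow (b ∷ bs) c) (map (δRow (b ∷ bs)) cs)
          (along-zero (All.map 𝟙-≟-< (c<b ∷ All.map (ℤP.<-trans c<b) (strict-head B↗)))))
        (sym (𝟙-no ((b ∷ bs) ≟ᴸ (c ∷ cs)) (λ eq → ℤP.<-irrefl (sym (LP.∷-injectiveˡ eq)) c<b)))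
... | tri> _ _ b<c =
  trans (det-∷-zero-column (δRow (b ∷ bs) c) (map (δRow (b ∷ bs)) cs) (δRows-first-column bs (All-<-≤ b<c (sorted-head c↗))))
   (trans (cong (_* det (map (_∘ suc) (map (δRow (b ∷ bs)) cs))) (𝟙-≟-> b<c))
          (sym (𝟙-no ((b ∷ bs) ≟ᴸ (c ∷ cs)) (λ eq → ℤP.<-irrefl (LP.∷-injectiveˡ eq) b<c))))
... | tri≈ _ refl _ with sorted-head-split c cs c↗
...   | inj₁ c<cs = begin
  det (map (δRow (c ∷ bs)) (c ∷ cs))
    ≡⟨ det-∷-zero-column (δRow (c ∷ bs) c) (map (δRow (c ∷ bs)) cs) (δRows-first-column bs c<cs) ⟩
  𝟙 (c ℤ.≟ c) * det (map (_∘ suc) (map (δRow (c ∷ bs)) cs))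
    ≡⟨ cong₂ _*_ (𝟙-yes (c ℤ.≟ c) refl) (cong det (sym (LP.map-∘ cs))) ⟩
  1ℤ * det (map (δRow bs) cs)
    ≡⟨ ℤP.*-identityˡ _ ⟩
  det (map (δRow bs) cs)
    ≡⟨ det-δRows bs cs (Linked.tail B↗) (Linked.tail c↗) (ℕP.suc-injective len) ⟩
  𝟙 (bs ≟ᴸ cs)
    ≡⟨ 𝟙-⇔ (bs ≟ᴸ cs) ((c ∷ bs) ≟ᴸ (c ∷ cs)) (cong (c ∷_)) LP.∷-injectiveʳ ⟩
  𝟙 ((c ∷ bs) ≟ᴸ (c ∷ cs)) ∎
  where
  open ≡-Reasoning
...   | inj₂ (cs′ , refl) with b′ ∷ bs′ ← bs | c<b′ ∷ _ ← B↗ =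
  trans (det-adjacent-equal [] (δRow (c ∷ b′ ∷ bs′) c) (δRow (c ∷ b′ ∷ bs′) c) (map (δRow (c ∷ b′ ∷ bs′)) cs′) (λ _ → refl))
        (sym (𝟙-no ((c ∷ b′ ∷ bs′) ≟ᴸ (c ∷ c ∷ cs′))
                   (λ eq → ℤP.<-irrefl (sym (LP.∷-injectiveˡ (LP.∷-injectiveʳ eq))) c<b′)))

atLeastRow : List ℤ → ℤ → Row
atLeastRow B x zero    = 1ℤ
atLeastRow B x (suc i) = along (λ b → 𝟙 (x ℤ.≤? b)) B i

𝟙-≟≡𝟙-≤-difference : ∀ x y → 𝟙 (x ℤ.≟ y) ≡ 𝟙 (x ℤ.≤? y) - 𝟙 (x + 1ℤ ℤ.≤? y)
𝟙-≟≡𝟙-≤-difference x y with ℤP.<-cmp x y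
... | tri< x<y _ _  = trans (𝟙-≟-< x<y)
  (sym (cong₂ _-_ (𝟙-yes (x ℤ.≤? y) (ℤP.<⇒≤ x<y)) (𝟙-yes (x + 1ℤ ℤ.≤? y) (<⇒+1≤ x<y))))
... | tri≈ _ refl _ = trans (𝟙-yes (x ℤ.≟ x) refl)
  (sym (cong₂ _-_ (𝟙-yes (x ℤ.≤? x) ℤP.≤-refl) (𝟙-no (x + 1ℤ ℤ.≤? x) (ℤP.<-irrefl refl ∘ +1≤⇒<))))
... | tri> _ _ y<x  = trans (𝟙-≟-> y<x)
  (sym (cong₂ _-_ (𝟙-no (x ℤ.≤? y) (ℤP.<⇒≱ y<x)) (𝟙-no (x + 1ℤ ℤ.≤? y) (ℤP.<-asym y<x ∘ +1≤⇒<))))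

interval-δRow : ∀ B a b i → intervalRow (δRow B) a b i ≡ - 1ℤ * differenceRow (atLeastRow B) a b (suc i)
interval-δRow []      a b i       = ∑ˢ-0 (interval a b)
interval-δRow (y ∷ B) a b (suc i) = interval-δRow B a b i
interval-δRow (y ∷ B) a b zero    =
  trans (∑ˢ-cong (interval a b) (λ x → trans (𝟙-≟≡𝟙-≤-difference x y) (negate (𝟙 (x ℤ.≤? y)) (𝟙 (x + 1ℤ ℤ.≤? y)))))
   (trans (∑ˢ-interval-telescope a b (λ x → - 𝟙 (x ℤ.≤? y))) (negate′ (𝟙 (b ℤ.≤? y)) (𝟙 (a ℤ.≤? y))))
  where
  negate : ∀ p q → p - q ≡ - q - - p
  negate = solve-∀
  negate′ : ∀ p q → - p - - q ≡ - 1ℤ * (p - q)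
  negate′ = solve-∀

inRange? : (a b y : ℤ) → Dec (a ≤ y × y < b)
inRange? a b y = (a ℤ.≤? y) ×-dec (y ℤ.<? b)

χRow : List ℤ → ℤ → ℤ → Row
χRow B a b = along (λ y → 𝟙 (inRange? a b y)) B

differenceRow-atLeast : ∀ B a b i → a ≤ b → differenceRow (atLeastRow B) a b (suc i) ≡ - 1ℤ * χRow B a b i
differenceRow-atLeast []      a b i       a≤b = refl
differenceRow-atLeast (y ∷ B) a b (suc i) a≤b = differenceRow-atLeast B a b i a≤b
differenceRow-atLeast (y ∷ B) a b zero    a≤b
  rewrite 𝟙-× (a ℤ.≤? y) (y ℤ.<? b) with a ℤ.≤? y | b ℤ.≤? y | y ℤ.<? b
... | yes _   | yes _   | no _    = refl
... | yes _   | no _    | yes _   = refl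
... | yes _   | yes b≤y | yes y<b = ⊥-elim (ℤP.<-irrefl refl (ℤP.<-≤-trans y<b b≤y))
... | yes _   | no b≰y  | no y≮b  = ⊥-elim (b≰y (ℤP.≮⇒≥ y≮b))
... | no _    | no _    | _       = refl
... | no a≰y  | yes b≤y | _       = ⊥-elim (a≰y (ℤP.≤-trans a≤b b≤y))

χRows-first-column : ∀ {b} bs cs → All (b <_) cs → All (λ v → v 0 ≡ 0ℤ) (consecutive (χRow (b ∷ bs)) cs)
χRows-first-column bs []            _            = []
χRows-first-column bs (c ∷ [])      _            = []
χRows-first-column bs (c ∷ c′ ∷ cs) (b<c ∷ b<cs) =
  𝟙-no (inRange? c c′ _) (ℤP.<⇒≱ b<c ∘ proj₁) ∷ χRows-first-column bs (c′ ∷ cs) b<cs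

det-χRows : ∀ B c → Strict B → Sorted c → suc (length B) ≡ length c → det (consecutive (χRow B) c) ≡ 𝟙 (Interlace? B c)
det-χRows []       (c₀ ∷ [])      _  _  _   = refl
det-χRows B@(b ∷ bs) (c₀ ∷ c₁ ∷ cs) B↗ c↗ len with b ℤ.<? c₀
... | yes b<c₀ =
  trans (det-∷-zero-column (χRow B c₀ c₁) (consecutive (χRow B) (c₁ ∷ cs))
          (χRows-first-column bs (c₁ ∷ cs) (All-<-≤ b<c₀ (sorted-head c↗))))
   (trans (cong (_* det (map (_∘ suc) (consecutive (χRow B) (c₁ ∷ cs)))) (𝟙-no (inRange? c₀ c₁ b) (c₀≰b ∘ proj₁)))
          (sym (𝟙-no (Interlace? B (c₀ ∷ c₁ ∷ cs)) (c₀≰b ∘ proj₁ ∘ proj₁))))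
  where
  c₀≰b : ¬ (c₀ ≤ b)
  c₀≰b = ℤP.<⇒≱ b<c₀
... | no b≮c₀ with c₁ ℤ.≤? b
...   | no c₁≰b = begin
  det (consecutive (χRow B) (c₀ ∷ c₁ ∷ cs))
    ≡⟨ det-∷-zero-column (χRow B c₀ c₁) (consecutive (χRow B) (c₁ ∷ cs))
                         (χRows-first-column bs (c₁ ∷ cs) (b<c₁ ∷ All-<-≤ b<c₁ (sorted-head (Linked.tail c↗)))) ⟩
  𝟙 (inRange? c₀ c₁ b) * det (map (_∘ suc) (consecutive (χRow B) (c₁ ∷ cs)))
    ≡⟨ cong₂ _*_ (𝟙-yes (inRange? c₀ c₁ b) (ℤP.≮⇒≥ b≮c₀ , b<c₁)) (cong det (map-consecutive (_∘ suc) (χRow B) (c₁ ∷ cs))) ⟩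
  1ℤ * det (consecutive (χRow bs) (c₁ ∷ cs))
    ≡⟨ ℤP.*-identityˡ _ ⟩
  det (consecutive (χRow bs) (c₁ ∷ cs))
    ≡⟨ det-χRows bs (c₁ ∷ cs) (Linked.tail B↗) (Linked.tail c↗) (ℕP.suc-injective len) ⟩
  𝟙 (Interlace? bs (c₁ ∷ cs))
    ≡⟨ 𝟙-⇔ (Interlace? bs (c₁ ∷ cs)) (Interlace? B (c₀ ∷ c₁ ∷ cs)) ((ℤP.≮⇒≥ b≮c₀ , b<c₁) ,_) proj₂ ⟩
  𝟙 (Interlace? B (c₀ ∷ c₁ ∷ cs)) ∎
  where
  open ≡-Reasoning
  b<c₁ : b < c₁
  b<c₁ = ℤP.≰⇒> c₁≰b
...   | yes c₁≤b =
  trans (det-zero-row [] (χRow B c₀ c₁) (consecutive (χRow B) (c₁ ∷ cs))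
          (along-zero (All.map (λ c₁≤b′ → 𝟙-no (inRange? c₀ c₁ _) (λ (_ , b′<c₁) → ℤP.<⇒≱ b′<c₁ c₁≤b′))
                               (c₁≤b ∷ All.map (λ b<b′ → ℤP.<⇒≤ (ℤP.≤-<-trans c₁≤b b<b′)) (strict-head B↗)))))
        (sym (𝟙-no (Interlace? B (c₀ ∷ c₁ ∷ cs)) (ℤP.≤⇒≯ c₁≤b ∘ proj₂ ∘ proj₁)))

occurs-below : ∀ b bs → All (b <_) bs → occurs b bs ≡ false
occurs-below b []       _            = refl
occurs-below b (y ∷ ys) (b<y ∷ b<ys) with b ℤ.≟ y
... | yes b≡y = ⊥-elim (ℤP.<-irrefl b≡y b<y)
... | no _    = occurs-below b ys b<ys

strict⇒no-tie : ∀ B → Strict B → hasTie B ≡ false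
strict⇒no-tie []       _  = refl
strict⇒no-tie (b ∷ bs) B↗ = cong₂ _∨_ (occurs-below b bs (strict-head B↗)) (strict⇒no-tie bs (Linked.tail B↗))

sorted∧no-tie⇒strict : ∀ B → Sorted B → hasTie B ≡ false → Strict B
sorted∧no-tie⇒strict []            _             _      = []
sorted∧no-tie⇒strict (b ∷ [])      _             _      = [-]
sorted∧no-tie⇒strict (b ∷ b′ ∷ bs) (b≤b′ ∷ B′↗) no-tie with b ℤ.≟ b′
... | yes _   with () ← BoolP.∨-conicalˡ true (hasTie (b′ ∷ bs)) no-tie
... | no b≢b′ =
  ℤP.≤∧≢⇒< b≤b′ b≢b′ ∷ sorted∧no-tie⇒strict (b′ ∷ bs) B′↗ (BoolP.∨-conicalʳ (occurs b bs) (hasTie (b′ ∷ bs)) no-tie)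

interlace⇒strict : ∀ B c → Interlace B c → Strict B
interlace⇒strict []            _                   _ = []
interlace⇒strict (b ∷ [])      _                   _ = [-]
interlace⇒strict (b ∷ b′ ∷ bs) (c₀ ∷ c₁ ∷ c₂ ∷ cs) ((_ , b<c₁) , rest@((c₁≤b′ , _) , _)) =
  ℤP.<-≤-trans b<c₁ c₁≤b′ ∷ interlace⇒strict (b′ ∷ bs) (c₁ ∷ c₂ ∷ cs) rest

∏<-sign-square : ∀ n → ∏< n (λ _ → - 1ℤ) * ∏< n (λ _ → - 1ℤ) ≡ 1ℤ
∏<-sign-square zero    = refl
∏<-sign-square (suc n) = trans (square (∏< n (λ _ → - 1ℤ))) (∏<-sign-square n)
  where
  square : ∀ p → (- 1ℤ * p) * (- 1ℤ * p) ≡ p * p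
  square = solve-∀

det-δRows-sort : ∀ B ls → Strict B → length ls ≡ length B → det (map (δRow B) ls) ≡ 𝟙 (B ≟ᴸ sort ls) * sgnL ls
det-δRows-sort B ls B↗ len = trans (det-sort (δRow B) ls)
  (trans (cong (sgnL ls *_) (det-δRows B (sort ls) B↗ (sort-↗ ls) (trans (↭-length (sort-↭ ls)) len)))
         (ℤP.*-comm (sgnL ls) _))

det-intervalRows-δ : ∀ B ks →
  det (consecutive (intervalRow (δRow B)) ks) ≡ ∏< (ℕ.pred (length ks)) (λ _ → - 1ℤ) * det (map (atLeastRow B) ks)
det-intervalRows-δ B ks =
  trans (det-scale-columns (consecutive-pointwise (λ a b i → interval-δRow B a b i) ks))
        (cong₂ (λ n d → ∏< n (λ _ → - 1ℤ) * d) (length-consecutive _ ks) (sym (det-differences (atLeastRow B) (λ _ → refl) ks)))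

det-atLeastRows : ∀ B c → Strict B → Sorted c → suc (length B) ≡ length c →
  det (map (atLeastRow B) c) ≡ ∏< (length B) (λ _ → - 1ℤ) * 𝟙 (Interlace? B c)
det-atLeastRows B c B↗ c↗ len =
  trans (det-differences (atLeastRow B) (λ _ → refl) c)
   (trans (det-scale-columns (consecutive-pointwise-linked (λ {a} {b} a≤b i → differenceRow-atLeast B a b i a≤b) c↗))
          (cong₂ (λ n d → ∏< n (λ _ → - 1ℤ) * d) (trans (length-consecutive (χRow B) c) (cong ℕ.pred (sym len)))
                 (det-χRows B c B↗ c↗ len)))

∑ˢ-intervals-sgn : ∀ m (k : Vec ℤ (suc (suc m))) B → Sorted B → length B ≡ suc m →
  ∑ˢ (intervals k) (λ l → 𝟙 (B ≟ᴸ sort (toList l)) * sgnL (toList l)) ≡ sgnL (toList k) * 𝟙 (Interlace? B (sort (toList k)))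
∑ˢ-intervals-sgn m k B B↗ len-B with hasTie B in tie
... | true  = begin
  ∑ˢ (intervals k) (λ l → 𝟙 (B ≟ᴸ sort (toList l)) * sgnL (toList l)) ≡⟨ ∑ˢ-cong (intervals k) no-term ⟩
  ∑ˢ (intervals k) (λ _ → 0ℤ)                                        ≡⟨ ∑ˢ-0 (intervals k) ⟩
  0ℤ                                                                 ≡⟨ ℤP.*-zeroʳ (sgnL (toList k)) ⟨
  sgnL (toList k) * 0ℤ                                               ≡⟨ cong (sgnL (toList k) *_) (𝟙-no (Interlace? B _) not-interlacing) ⟨
  sgnL (toList k) * 𝟙 (Interlace? B (sort (toList k)))               ∎
  where
  open ≡-Reasoning
  not-interlacing : ¬ Interlace B (sort (toList k))
  not-interlacing B⋈c with () ← trans (sym tie) (strict⇒no-tie B (interlace⇒strict B _ B⋈c))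
  no-term : ∀ l → 𝟙 (B ≟ᴸ sort (toList l)) * sgnL (toList l) ≡ 0ℤ
  no-term l with B ≟ᴸ sort (toList l)
  ... | no _    = refl
  ... | yes B≡c = cong (1ℤ *_) (sgnL-tie (toList l) (trans (sym (hasTie-↭ (sort-↭ (toList l)))) (trans (cong hasTie (sym B≡c)) tie)))
... | false = begin
  ∑ˢ (intervals k) (λ l → 𝟙 (B ≟ᴸ sort (toList l)) * sgnL (toList l))
    ≡⟨ ∑ˢ-cong (intervals k) (λ l → sym (det-δRows-sort B (toList l) B-strict (trans (VP.length-toList l) (sym len-B)))) ⟩
  ∑ˢ (intervals k) (λ l → det ([] ++ map (δRow B) (toList l)))
    ≡⟨ ∑ˢ-intervals-det m k (δRow B) [] ⟩
  det (consecutive (intervalRow (δRow B)) ks)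
    ≡⟨ det-intervalRows-δ B ks ⟩
  ∏< (ℕ.pred (length ks)) (λ _ → - 1ℤ) * det (map (atLeastRow B) ks)
    ≡⟨ cong₂ (λ n d → ∏< n (λ _ → - 1ℤ) * d) (cong ℕ.pred (VP.length-toList k)) (det-sort (atLeastRow B) ks) ⟩
  ε * (sgnL ks * det (map (atLeastRow B) c))
    ≡⟨ cong (λ d → ε * (sgnL ks * d)) (det-atLeastRows B c B-strict (sort-↗ ks) length-c) ⟩
  ε * (sgnL ks * (∏< (length B) (λ _ → - 1ℤ) * 𝟙 (Interlace? B c)))
    ≡⟨ cong (λ n → ε * (sgnL ks * (∏< n (λ _ → - 1ℤ) * 𝟙 (Interlace? B c)))) len-B ⟩
  ε * (sgnL ks * (ε * 𝟙 (Interlace? B c)))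
    ≡⟨ cancel ε (sgnL ks) (𝟙 (Interlace? B c)) (∏<-sign-square (suc m)) ⟩
  sgnL ks * 𝟙 (Interlace? B c) ∎
  where
  open ≡-Reasoning
  ks = toList k
  c = sort ks
  ε = ∏< (suc m) (λ _ → - 1ℤ)
  B-strict : Strict B
  B-strict = sorted∧no-tie⇒strict B B↗ tie
  length-c : suc (length B) ≡ length c
  length-c = trans (cong suc len-B) (sym (trans (↭-length (sort-↭ ks)) (VP.length-toList k)))
  cancel : ∀ e s i → e * e ≡ 1ℤ → e * (s * (e * i)) ≡ s * i
  cancel e s i e²≡1 = trans (regroup e s i) (trans (cong (_* (s * i)) e²≡1) (ℤP.*-identityˡ (s * i)))
    where
    regroup : ∀ e s i → e * (s * (e * i)) ≡ (e * e) * (s * i)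
    regroup = solve-∀

ConsecInterlace? : ∀ rs → Dec (ConsecInterlace rs)
ConsecInterlace? []            = yes tt
ConsecInterlace? (r ∷ [])      = yes tt
ConsecInterlace? (r ∷ r′ ∷ rs) = Interlace? r r′ ×-dec ConsecInterlace? (r′ ∷ rs)

IsClassicalGT? : ∀ {n} (A : MSTuple n) → Dec (IsClassicalGT A)
IsClassicalGT? A = ConsecInterlace? (tupleRows A)

ConsecInterlace-∷ʳ⁻ : ∀ rs b a → ConsecInterlace (rs ∷ʳ b ∷ʳ a) → ConsecInterlace (rs ∷ʳ b) × Interlace b a
ConsecInterlace-∷ʳ⁻ []            b a (b⋈a , _) = tt , b⋈a
ConsecInterlace-∷ʳ⁻ (r ∷ [])      b a (r⋈b , b⋈a , _) = (r⋈b , tt) , b⋈a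
ConsecInterlace-∷ʳ⁻ (r ∷ r′ ∷ rs) b a (r⋈r′ , rest) with ConsecInterlace-∷ʳ⁻ (r′ ∷ rs) b a rest
... | rest′ , b⋈a = (r⋈r′ , rest′) , b⋈a

ConsecInterlace-∷ʳ⁺ : ∀ rs b a → ConsecInterlace (rs ∷ʳ b) → Interlace b a → ConsecInterlace (rs ∷ʳ b ∷ʳ a)
ConsecInterlace-∷ʳ⁺ []            b a _              b⋈a = b⋈a , tt
ConsecInterlace-∷ʳ⁺ (r ∷ [])      b a (r⋈b , _)      b⋈a = r⋈b , b⋈a , tt
ConsecInterlace-∷ʳ⁺ (r ∷ r′ ∷ rs) b a (r⋈r′ , rest′) b⋈a = r⋈r′ , ConsecInterlace-∷ʳ⁺ (r′ ∷ rs) b a rest′ b⋈a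

𝟙-ConsecInterlace-∷ʳ : ∀ rs b a → 𝟙 (ConsecInterlace? (rs ∷ʳ b ∷ʳ a)) ≡ 𝟙 (ConsecInterlace? (rs ∷ʳ b)) * 𝟙 (Interlace? b a)
𝟙-ConsecInterlace-∷ʳ rs b a =
  trans (𝟙-⇔ (ConsecInterlace? (rs ∷ʳ b ∷ʳ a)) (ConsecInterlace? (rs ∷ʳ b) ×-dec Interlace? b a)
          (ConsecInterlace-∷ʳ⁻ rs b a) (λ (p , q) → ConsecInterlace-∷ʳ⁺ rs b a p q))
        (𝟙-× (ConsecInterlace? (rs ∷ʳ b)) (Interlace? b a))

toList-tabulate-∷ʳ : ∀ n (f : Fin (suc n) → A) →
  toList (V.tabulate f) ≡ toList (V.tabulate (f ∘ inject₁)) ∷ʳ f (fromℕ n)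
toList-tabulate-∷ʳ zero    f = refl
toList-tabulate-∷ʳ (suc n) f = cong (f F.zero ∷_) (toList-tabulate-∷ʳ n (f ∘ F.suc))

initTuple : ∀ {m} → MSTuple (suc (suc m)) → MSTuple (suc m)
initTuple A i = subst (MS ∘ suc) (FP.toℕ-inject₁ i) (A (inject₁ i))

tupleRows-∷ʳ : ∀ {m} (A : MSTuple (suc (suc m))) → tupleRows A ≡ tupleRows (initTuple A) ∷ʳ msList (A (fromℕ (suc m)))
tupleRows-∷ʳ {m} A = trans (toList-tabulate-∷ʳ (suc m) (msList ∘ A))
  (cong (_∷ʳ msList (A (fromℕ (suc m)))) (cong toList (VP.tabulate-cong (λ i → sym (msList-subst (FP.toℕ-inject₁ i) (A (inject₁ i)))))))
  where
  msList-subst : ∀ {a b} (eq : a ≡ b) (x : MS (suc a)) → msList (subst (MS ∘ suc) eq x) ≡ msList x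
  msList-subst refl x = refl

_≟ᴸᴸ_ : (xss yss : List (List ℤ)) → Dec (xss ≡ yss)
_≟ᴸᴸ_ = LP.≡-dec _≟ᴸ_

𝟙-ηrow-∷ʳ : ∀ p ks R a → 𝟙 (ηrow (p ∷ʳ ks) ≟ᴸᴸ (R ∷ʳ a)) ≡ 𝟙 (sort ks ≟ᴸ a) * 𝟙 (ηrow p ≟ᴸᴸ R)
𝟙-ηrow-∷ʳ p ks R a =
  trans (𝟙-⇔ (ηrow (p ∷ʳ ks) ≟ᴸᴸ (R ∷ʳ a)) ((sort ks ≟ᴸ a) ×-dec (ηrow p ≟ᴸᴸ R))
          (λ eq → let p≡R , ks≡a = LP.∷ʳ-injective (ηrow p) R (trans (sym (LP.map-++ sort p (ks ∷ []))) eq) in ks≡a , p≡R)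
          (λ (ks≡a , p≡R) → trans (LP.map-++ sort p (ks ∷ [])) (cong₂ _∷ʳ_ p≡R ks≡a)))
        (𝟙-× (sort ks ≟ᴸ a) (ηrow p ≟ᴸᴸ R))

size-restrictRow-GT-suc : ∀ m (k : Vec ℤ (suc (suc m))) (A : MSTuple (suc (suc m))) →
  size (restrictRow (GT (suc m) k) A) ≡
    𝟙 (sort (toList k) ≟ᴸ msList (A (fromℕ (suc m)))) * ∑ˢ (intervals k) (λ l → size (restrictRow (GT m l) (initTuple A)))
size-restrictRow-GT-suc m k A = begin
  size (restrictRow (GT (suc m) k) A)
    ≡⟨ size-restrict _≟ᴸᴸ_ ηrow (tupleRows A) (GT (suc m) k) ⟩
  ∑ˢ (GT (suc m) k) (λ p → 𝟙 (ηrow p ≟ᴸᴸ tupleRows A))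
    ≡⟨ ∑ˢ-⨆ (intervals k) _ _ ⟩
  ∑ˢ (intervals k) (λ l → ∑ˢ (mapS (_∷ʳ toList k) (GT m l)) (λ p → 𝟙 (ηrow p ≟ᴸᴸ tupleRows A)))
    ≡⟨ ∑ˢ-cong (intervals k) (λ l → trans (∑ˢ-mapS (_∷ʳ toList k) (GT m l) _) (∑ˢ-cong (GT m l) (λ p → last-row p))) ⟩
  ∑ˢ (intervals k) (λ l → ∑ˢ (GT m l) (λ p → α * 𝟙 (ηrow p ≟ᴸᴸ tupleRows (initTuple A))))
    ≡⟨ ∑ˢ-cong (intervals k) (λ l → trans (*-distribˡ-∑ˢ (GT m l) α _)
                                           (cong (α *_) (sym (size-restrict _≟ᴸᴸ_ ηrow (tupleRows (initTuple A)) (GT m l))))) ⟩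
  ∑ˢ (intervals k) (λ l → α * size (restrictRow (GT m l) (initTuple A)))
    ≡⟨ *-distribˡ-∑ˢ (intervals k) α _ ⟩
  α * ∑ˢ (intervals k) (λ l → size (restrictRow (GT m l) (initTuple A))) ∎
  where
  open ≡-Reasoning
  α = 𝟙 (sort (toList k) ≟ᴸ msList (A (fromℕ (suc m))))
  last-row : ∀ p → 𝟙 (ηrow (p ∷ʳ toList k) ≟ᴸᴸ tupleRows A) ≡ α * 𝟙 (ηrow p ≟ᴸᴸ tupleRows (initTuple A))
  last-row p = trans (cong (λ R → 𝟙 (ηrow (p ∷ʳ toList k) ≟ᴸᴸ R)) (tupleRows-∷ʳ A)) (𝟙-ηrow-∷ʳ p (toList k) _ _)

𝟙-IsClassicalGT-initTuple : ∀ {m} (A : MSTuple (suc (suc m))) →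
  𝟙 (IsClassicalGT? A) ≡
    𝟙 (IsClassicalGT? (initTuple A)) * 𝟙 (Interlace? (msList (initTuple A (fromℕ m))) (msList (A (fromℕ (suc m)))))
𝟙-IsClassicalGT-initTuple {m} A =
  trans (cong (𝟙 ∘ ConsecInterlace?) (trans (tupleRows-∷ʳ A) (cong (_∷ʳ a) rows′)))
   (trans (𝟙-ConsecInterlace-∷ʳ init′ b a) (cong (λ R → 𝟙 (ConsecInterlace? R) * 𝟙 (Interlace? b a)) (sym rows′)))
  where
  a = msList (A (fromℕ (suc m)))
  b = msList (initTuple A (fromℕ m))
  init′ = toList (V.tabulate (msList ∘ initTuple A ∘ inject₁))
  rows′ : tupleRows (initTuple A) ≡ init′ ∷ʳ b
  rows′ = toList-tabulate-∷ʳ m (msList ∘ initTuple A)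

size-restrictRow-GT : ∀ m (k : Vec ℤ (suc m)) (A : MSTuple (suc m)) →
  size (restrictRow (GT m k) A) ≡ 𝟙 (msList (A (fromℕ m)) ≟ᴸ sort (toList k)) * 𝟙 (IsClassicalGT? A) * sgn k
size-restrictRow-GT zero (x ∷ []) A =
  trans (size-restrict _≟ᴸᴸ_ ηrow (tupleRows A) (GT zero (x ∷ [])))
   (trans (cong (λ i → (i + 0ℤ) - 0ℤ) (𝟙-⇔ (ηrow ((x ∷ []) ∷ []) ≟ᴸᴸ tupleRows A) (msList (A F.zero) ≟ᴸ sort (x ∷ []))
                                           (sym ∘ LP.∷-injectiveˡ) (λ eq → cong (_∷ []) (sym eq))))
          (simplify (𝟙 (msList (A F.zero) ≟ᴸ sort (x ∷ [])))))
  where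
  simplify : ∀ i → (i + 0ℤ) - 0ℤ ≡ i * 1ℤ * 1ℤ
  simplify = solve-∀
size-restrictRow-GT (suc m) k A with sort (toList k) ≟ᴸ msList (A (fromℕ (suc m)))
... | no sort[k]≢a =
  trans (size-restrictRow-GT-suc m k A)
    (trans (cong (_* ∑ˢ (intervals k) _) (𝟙-no (sort (toList k) ≟ᴸ _) sort[k]≢a))
           (sym (cong (λ x → x * 𝟙 (IsClassicalGT? A) * sgn k) (𝟙-no (_ ≟ᴸ sort (toList k)) (sort[k]≢a ∘ sym)))))
... | yes sort[k]≡a = begin
  size (restrictRow (GT (suc m) k) A)
    ≡⟨ size-restrictRow-GT-suc m k A ⟩
  𝟙 (sort (toList k) ≟ᴸ a) * ∑ˢ (intervals k) (λ l → size (restrictRow (GT m l) A′))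
    ≡⟨ cong₂ _*_ (𝟙-yes (sort (toList k) ≟ᴸ a) sort[k]≡a) (∑ˢ-cong (intervals k) (λ l → size-restrictRow-GT m l A′)) ⟩
  1ℤ * ∑ˢ (intervals k) (λ l → 𝟙 (b ≟ᴸ sort (toList l)) * γ′ * sgn l)
    ≡⟨ trans (ℤP.*-identityˡ _) (∑ˢ-cong (intervals k) (λ l → regroup (𝟙 (b ≟ᴸ sort (toList l))) γ′ (sgn l))) ⟩
  ∑ˢ (intervals k) (λ l → γ′ * (𝟙 (b ≟ᴸ sort (toList l)) * sgn l))
    ≡⟨ *-distribˡ-∑ˢ (intervals k) γ′ _ ⟩
  γ′ * ∑ˢ (intervals k) (λ l → 𝟙 (b ≟ᴸ sort (toList l)) * sgn l)
    ≡⟨ cong (γ′ *_) (∑ˢ-intervals-sgn m k b (proj₂ (A′ (fromℕ m))) length-b) ⟩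
  γ′ * (sgn k * 𝟙 (Interlace? b (sort (toList k))))
    ≡⟨ cong (λ c → γ′ * (sgn k * 𝟙 (Interlace? b c))) sort[k]≡a ⟩
  γ′ * (sgn k * 𝟙 (Interlace? b a))
    ≡⟨ regroup′ γ′ (sgn k) (𝟙 (Interlace? b a)) ⟩
  1ℤ * (γ′ * 𝟙 (Interlace? b a)) * sgn k
    ≡⟨ cong₂ (λ x y → x * y * sgn k) (sym (𝟙-yes (a ≟ᴸ sort (toList k)) (sym sort[k]≡a))) (sym (𝟙-IsClassicalGT-initTuple A)) ⟩
  𝟙 (a ≟ᴸ sort (toList k)) * 𝟙 (IsClassicalGT? A) * sgn k ∎
  where
  open ≡-Reasoning
  A′ = initTuple A
  a = msList (A (fromℕ (suc m)))
  b = msList (A′ (fromℕ m))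
  γ′ = 𝟙 (IsClassicalGT? A′)
  length-b : length b ≡ suc m
  length-b = trans (VP.length-toList (proj₁ (A′ (fromℕ m)))) (cong suc (FP.toℕ-fromℕ m))
  regroup : ∀ x g s → x * g * s ≡ g * (x * s)
  regroup = solve-∀
  regroup′ : ∀ g s i → g * (s * i) ≡ 1ℤ * (g * i) * s
  regroup′ = solve-∀

size-restrictRow-GT-sorted : ∀ m (k : Vec ℤ (suc m)) (A : MSTuple (suc m)) → msList (A (fromℕ m)) ≡ sort (toList k) →
  size (restrictRow (GT m k) A) ≡ 𝟙 (IsClassicalGT? A) * sgn k
size-restrictRow-GT-sorted m k A last≡sort[k] = trans (size-restrictRow-GT m k A)
  (trans (cong (λ x → x * 𝟙 (IsClassicalGT? A) * sgn k) (𝟙-yes (_ ≟ᴸ _) last≡sort[k]))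
         (cong (_* sgn k) (ℤP.*-identityˡ (𝟙 (IsClassicalGT? A)))))

mainTheorem2 : (m : ℕ) (k : Vec ℤ (suc m)) →
    ((A : MSTuple (suc m)) → msList (A (fromℕ m)) ≡ sort (toList k) →
      (IsClassicalGT A → size (restrictRow (GT m k) A) ≡ sgn k)
      × (¬ IsClassicalGT A → size (restrictRow (GT m k) A) ≡ + 0))
    × ((k′ : Vec ℤ (suc m)) → toList k′ ≡ sort (toList k) →
      size (GT m k) ≡ sgn k * size (GT m k′))
    × (size (GT m k) / 1 ≡ prodFormula (toList k))
mainTheorem2 m k =
    (λ A last≡sort[k] →
         (λ classical → trans (size-restrictRow-GT-sorted m k A last≡sort[k])
                              (trans (cong (_* sgn k) (𝟙-yes (IsClassicalGT? A) classical)) (ℤP.*-identityˡ (sgn k))))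
       , (λ ¬classical → trans (size-restrictRow-GT-sorted m k A last≡sort[k])
                               (trans (cong (_* sgn k) (𝟙-no (IsClassicalGT? A) ¬classical)) (ℤP.*-zeroˡ (sgn k)))))
  , size-GT-sort m k
  , size-GT/1≡prodFormula m k
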